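{- Let $q$ be a prime power, $m$ a positive integer, $s$ a positive integer and $k=2s+1$. Let $S$ be an $\mathbb{F}_q$-subspace of $\mathbb{F}_{q^m}$ of dimension $i$ and \[U=\{(x_1+\zeta,x_1^q,x_1^{q^2},x_2,x_2^q,\ldots,x_s,x_s^q) : x_1,\ldots,x_s\in\mathbb{F}_{q^m},\ \zeta\in S\}\subseteq\mathbb{F}_{q^m}^k.\] Then $L_U$ is an $i$-club in $\mathrm{PG}(k-1,q^m)$ of rank $\frac{m(k-1)}{2}+i$.
   Context: $L_U=\{\langle u\rangle_{\mathbb{F}_{q^m}} : u\in U\setminus\{0\}\}$ has rank $\dim_{\mathbb{F}_q}U$; the weight of a point $\langle v\rangle_{\mathbb{F}_{q^m}}$ is $\dim_{\mathbb{F}_q}(U\cap\langle v\rangle_{\mathbb{F}_{q^m}})$; $L_U$ is an $i$-club if exactly one point of $L_U$ has weight $i$ and all others weight $1$. -}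

module Defs where

open import Level using (0ℓ)
open import Algebra.Bundles using (CommutativeRing)
open import Data.Nat as ℕ using (ℕ; zero; suc)
open import Data.Nat.Primality using (Prime)
open import Data.Fin using (Fin)
open import Data.Vec using (Vec; []; _∷_; zipWith; map; replicate; head)
open import Data.Vec.Relation.Unary.All using (All)
open import Data.Vec.Relation.Binary.Pointwise.Inductive using (Pointwise)
open import Data.Product using (Σ; ∃; _×_; _,_)
open import Relation.Nullary using (¬_)
open import Relation.Binary.PropositionalEquality as ≡ using (_≡_)
open import Function.Bundles using (Inverse)

IsPrimePower : ℕ → Set
IsPrimePower q = ∃ λ p → ∃ λ e → Prime p × (1 ℕ.≤ e) × (q ≡ p ℕ.^ e)

module _ (R : CommutativeRing 0ℓ 0ℓ) where
  open CommutativeRing R renaming (Carrier to F)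

  IsField : Set
  IsField = (¬ (1# ≈ 0#)) × (∀ x → ¬ (x ≈ 0#) → ∃ λ y → (x * y) ≈ 1#)

  HasSize : ℕ → Set
  HasSize n = Inverse (≡.setoid (Fin n)) setoid

  pow : F → ℕ → F
  pow x zero = 1#
  pow x (suc n) = x * pow x n

  _≋_ : {n : ℕ} → Vec F n → Vec F n → Set
  _≋_ = Pointwise _≈_

  0v : {n : ℕ} → Vec F n
  0v = replicate _ 0#

  _⊕_ : {n : ℕ} → Vec F n → Vec F n → Vec F n
  _⊕_ = zipWith _+_

  _·_ : {n : ℕ} → F → Vec F n → Vec F n
  a · v = map (a *_) v

  comb : {n d : ℕ} → Vec F d → Vec (Vec F n) d → Vec F n
  comb [] [] = 0v
  comb (a ∷ as) (b ∷ bs) = (a · b) ⊕ comb as bs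

  module _ (q : ℕ) where

    -- the subfield F_q = { x | x^q = x } of F_{q^m}
    InFq : F → Set
    InFq x = pow x q ≈ x

    -- W ⊆ F^n is an F_q-subspace of F_q-dimension d:
    -- it has an F_q-basis of length d (F_q-linearly independent, and W = its F_q-span)
    HasDimFq : {n : ℕ} → (Vec F n → Set) → ℕ → Set
    HasDimFq {n} W d =
      Σ (Vec (Vec F n) d) λ b →
        (∀ a → All InFq a → comb a b ≋ 0v → All (_≈ 0#) a) ×
        (∀ a → All InFq a → W (comb a b)) ×
        (∀ v → W v → ∃ λ a → All InFq a × (v ≋ comb a b))

    HasDimFq₁ : (F → Set) → ℕ → Set
    HasDimFq₁ S i = HasDimFq {1} (λ v → S (head v)) i

    pairs : {t : ℕ} → Vec F t → Vec F (t ℕ.* 2)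
    pairs [] = []
    pairs (x ∷ xs) = x ∷ pow x q ∷ pairs xs

    -- (x_1 + ζ, x_1^q, x_1^{q^2}, x_2, x_2^q, ..., x_s, x_s^q) ∈ F^(2s+1)
    -- (the case s = 0 is excluded by hypothesis and given an arbitrary value)
    uVec : {s : ℕ} → Vec F s → F → Vec F (1 ℕ.+ s ℕ.* 2)
    uVec [] ζ = ζ ∷ []
    uVec (x ∷ xs) ζ = (x + ζ) ∷ pow x q ∷ pow x (q ℕ.^ 2) ∷ pairs xs

    Uset : (s : ℕ) → (F → Set) → Vec F (1 ℕ.+ s ℕ.* 2) → Set
    Uset s S v = ∃ λ (x : Vec F s) → ∃ λ ζ → S ζ × (v ≋ uVec x ζ)

    Weight : {n : ℕ} → (Vec F n → Set) → Vec F n → ℕ → Set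
    Weight U v w = HasDimFq (λ x → U x × ∃ λ c → x ≋ (c · v)) w

    NonZeroV : {n : ℕ} → Vec F n → Set
    NonZeroV v = ¬ (v ≋ 0v)

    -- ⟨u'⟩ = ⟨u⟩ as projective points (u, u' nonzero)
    SamePoint : {n : ℕ} → Vec F n → Vec F n → Set
    SamePoint u' u = ∃ λ c → u' ≋ (c · u)

    IsClub : {n : ℕ} → (Vec F n → Set) → ℕ → Set
    IsClub U i =
      ∃ λ u → U u × NonZeroV u × Weight U u i ×
        (∀ u' → U u' → NonZeroV u' → ¬ SamePoint u' u →
           Weight U u' 1 × ¬ Weight U u' i)

    HasRank : {n : ℕ} → (Vec F n → Set) → ℕ → Set
    HasRank U r = HasDimFq U r

-- Write F = F_{q^m}. As q is a power of the characteristic, x ↦ x^q is additive; its fixed points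
-- form a subfield F_q with exactly q elements, so F is an m-dimensional F_q-space. The map
-- (ζ, x₁, …, x_s) ↦ (x₁ + ζ, x₁^q, x₁^{q²}, x₂, x₂^q, …, x_s, x_s^q) is F_q-linear and injective
-- from S × F^s onto U, so U has rank i + ms. The point ⟨(ζ₀, 0, …, 0)⟩ with ζ₀ ∈ S nonzero meets U
-- in {(ζ, 0, …, 0) : ζ ∈ S}, of dimension i. Every other point ⟨u⟩ of L_U has some x_j ≠ 0, and
-- if c u ∈ U then comparing the coordinates (x₁^q, x₁^{q²}) or (x_j, x_j^q) of u and c u gives
-- c^q = c; so U ∩ ⟨u⟩ = F_q u and ⟨u⟩ has weight 1.

module Submission where

open import Level using (0ℓ)
open import Algebra.Bundles using (CommutativeRing; CommutativeMonoid)
open import Data.Bool using (Bool; true; false; not; T; if_then_else_)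
open import Data.Empty using (⊥-elim)
open import Data.Fin as Fin using (Fin; toℕ)
import Data.Fin.Properties as Fin
open import Data.Fin.Permutation using (Permutation′; permutation)
open import Data.Nat as ℕ using (ℕ; zero; suc; _≤_; _<_; z≤n; s≤s)
import Data.Nat.Properties as ℕ
open import Data.Nat.Combinatorics using (_C_; nCn≡1; nC1≡n; nCk+nC[k+1]≡[n+1]C[k+1])
open import Data.Nat.Divisibility using (_∣_; divides; ∣⇒≤)
open import Data.Nat.Primality using (Prime; euclidsLemma; ¬prime[0]; prime⇒nonTrivial; prime⇒nonZero)
open import Data.Nat.Tactic.RingSolver using (solve-∀)
open import Data.Product using (∃; ∃₂; _×_; _,_; proj₁; proj₂)
open import Data.Sum using (_⊎_; inj₁; inj₂)
open import Data.Unit using (⊤; tt)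
open import Data.Vec as Vec using (Vec; []; _∷_; _++_; head; map; zipWith; replicate)
import Data.Vec.Properties as Vec
open import Data.Vec.Relation.Unary.All as All using (All; []; _∷_)
import Data.Vec.Relation.Unary.All.Properties as AllP
open import Data.Vec.Relation.Binary.Pointwise.Inductive as Pointwise using ([]; _∷_)
open import Function using (_∘_; id)
open import Function.Bundles using (Inverse)
open import Function.Definitions using (Injective)
open import Relation.Binary.PropositionalEquality as ≡ using (_≡_; _≢_)
open import Relation.Nullary using (¬_; Dec; yes; no; contradiction)
open import Relation.Nullary.Decidable as Dec using (isYes; toWitness; fromWitness; toWitnessFalse)
open import Defs as D
  using (IsPrimePower; IsField; HasSize; pow; InFq; HasDimFq; HasDimFq₁; pairs; uVec; Uset; Weight; NonZeroV; SamePoint; IsClub; HasRank)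

[1+k]*[1+n]C[1+k]≡[1+n]*nCk : ∀ n k → suc k ℕ.* (suc n C suc k) ≡ suc n ℕ.* (n C k)
[1+k]*[1+n]C[1+k]≡[1+n]*nCk zero zero = ≡.refl
[1+k]*[1+n]C[1+k]≡[1+n]*nCk zero (suc k) = ℕ.*-zeroʳ (suc (suc k))
[1+k]*[1+n]C[1+k]≡[1+n]*nCk (suc n) zero =
  ≡.trans (ℕ.+-identityʳ _) (≡.trans (nC1≡n (suc (suc n))) (≡.sym (ℕ.*-identityʳ _)))
[1+k]*[1+n]C[1+k]≡[1+n]*nCk (suc n) (suc k) = begin
  suc (suc k) ℕ.* (suc (suc n) C suc (suc k))
    ≡⟨ ≡.cong (suc (suc k) ℕ.*_) (nCk+nC[k+1]≡[n+1]C[k+1] (suc n) (suc k)) ⟨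
  suc (suc k) ℕ.* (A ℕ.+ B)
    ≡⟨ ℕ.*-distribˡ-+ (suc (suc k)) A B ⟩
  A ℕ.+ suc k ℕ.* A ℕ.+ suc (suc k) ℕ.* B
    ≡⟨ ≡.cong₂ (λ u v → A ℕ.+ u ℕ.+ v) ([1+k]*[1+n]C[1+k]≡[1+n]*nCk n k) ([1+k]*[1+n]C[1+k]≡[1+n]*nCk n (suc k)) ⟩
  A ℕ.+ suc n ℕ.* (n C k) ℕ.+ suc n ℕ.* (n C suc k)
    ≡⟨ ℕ.+-assoc A _ _ ⟩
  A ℕ.+ (suc n ℕ.* (n C k) ℕ.+ suc n ℕ.* (n C suc k))
    ≡⟨ ≡.cong (A ℕ.+_) (ℕ.*-distribˡ-+ (suc n) (n C k) (n C suc k)) ⟨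
  A ℕ.+ suc n ℕ.* (n C k ℕ.+ n C suc k)
    ≡⟨ ≡.cong (λ c → A ℕ.+ suc n ℕ.* c) (nCk+nC[k+1]≡[n+1]C[k+1] n k) ⟩
  suc (suc n) ℕ.* A ∎
  where
  open ≡.≡-Reasoning
  A B : ℕ
  A = suc n C suc k
  B = suc n C suc (suc k)

p∣pCk : ∀ {p k} → Prime p → 0 < k → k < p → p ∣ p C k
p∣pCk {suc n} {suc k} p-prime _ k<p
  with euclidsLemma (suc k) (suc n C suc k) p-prime
         (divides (n C k) (≡.trans ([1+k]*[1+n]C[1+k]≡[1+n]*nCk n k) (ℕ.*-comm (suc n) (n C k))))
... | inj₂ p∣pCk = p∣pCk
... | inj₁ p∣1+k = contradiction (∣⇒≤ p∣1+k) (ℕ.<⇒≱ k<p)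

1<p^e : ∀ {p e} → Prime p → 1 ≤ e → 1 < p ℕ.^ e
1<p^e {p} {suc e} p-prime _ =
  ℕ.<-≤-trans (ℕ.nonTrivial⇒n>1 p {{prime⇒nonTrivial p-prime}})
              (ℕ.m≤m*n p (p ℕ.^ e) {{ℕ.m^n≢0 p e {{prime⇒nonZero p-prime}}}})

[1+a]^m≡1+a*[1+M] : ∀ a m → 1 ≤ m → ∃ λ M → suc a ℕ.^ m ≡ suc (a ℕ.* suc M)
[1+a]^m≡1+a*[1+M] a (suc zero)    _ = 0 , solve-∀
[1+a]^m≡1+a*[1+M] a (suc (suc m)) _ with M , eq ← [1+a]^m≡1+a*[1+M] a (suc m) (s≤s z≤n) =
  suc a ℕ.* suc M , ≡.trans (≡.cong (suc a ℕ.*_) eq) (identity a (suc M))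
  where
  identity : ∀ a b → suc a ℕ.* suc (a ℕ.* b) ≡ suc (a ℕ.* suc (suc a ℕ.* b))
  identity = solve-∀

funToFin-cong : ∀ {m n} {f g : Fin m → Fin n} → (∀ i → f i ≡ g i) → Fin.funToFin f ≡ Fin.funToFin g
funToFin-cong {zero}  _   = ≡.refl
funToFin-cong {suc m} f≗g = ≡.cong₂ Fin.combine (f≗g Fin.zero) (funToFin-cong (f≗g ∘ Fin.suc))

count : ∀ {n} → (Fin n → Bool) → ℕ
count {zero}  b = 0
count {suc n} b = if b Fin.zero then suc (count (b ∘ Fin.suc)) else count (b ∘ Fin.suc)

select : ∀ {n} (b : Fin n → Bool) → Fin (count b) → Fin n
select {suc n} b k with b Fin.zero
select {suc n} b Fin.zero    | true  = Fin.zero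
select {suc n} b (Fin.suc k) | true  = Fin.suc (select (b ∘ Fin.suc) k)
select {suc n} b k           | false = Fin.suc (select (b ∘ Fin.suc) k)

select-true : ∀ {n} (b : Fin n → Bool) k → T (b (select b k))
select-true {suc n} b k with b Fin.zero in b₀≡
select-true {suc n} b Fin.zero    | true rewrite b₀≡ = _
select-true {suc n} b (Fin.suc k) | true  = select-true (b ∘ Fin.suc) k
select-true {suc n} b k           | false = select-true (b ∘ Fin.suc) k

select-injective : ∀ {n} (b : Fin n → Bool) → Injective _≡_ _≡_ (select b)
select-injective {suc n} b {k} {l} eq with b Fin.zero
select-injective {suc n} b {Fin.zero}  {Fin.zero}  eq | true  = ≡.refl
select-injective {suc n} b {Fin.suc k} {Fin.suc l} eq | true  =
  ≡.cong Fin.suc (select-injective (b ∘ Fin.suc) (Fin.suc-injective eq))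
select-injective {suc n} b {k}         {l}         eq | false =
  select-injective (b ∘ Fin.suc) (Fin.suc-injective eq)

select-surjective : ∀ {n} (b : Fin n → Bool) i → T (b i) → ∃ λ k → select b k ≡ i
select-surjective {suc n} b i bi with b Fin.zero in b₀≡
select-surjective {suc n} b Fin.zero    bi | true = Fin.zero , ≡.refl
select-surjective {suc n} b (Fin.suc i) bi | true
  with k , eq ← select-surjective (b ∘ Fin.suc) i bi = Fin.suc k , ≡.cong Fin.suc eq
select-surjective {suc n} b Fin.zero    bi | false rewrite b₀≡ = ⊥-elim bi
select-surjective {suc n} b (Fin.suc i) bi | false
  with k , eq ← select-surjective (b ∘ Fin.suc) i bi = k , ≡.cong Fin.suc eq

count+count-not≡n : ∀ {n} (b : Fin n → Bool) → count b ℕ.+ count (not ∘ b) ≡ n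
count+count-not≡n {zero}  b = ≡.refl
count+count-not≡n {suc n} b with b Fin.zero
... | true  = ≡.cong suc (count+count-not≡n (b ∘ Fin.suc))
... | false = ≡.trans (ℕ.+-suc _ _) (≡.cong suc (count+count-not≡n (b ∘ Fin.suc)))

module Powers (R : CommutativeRing 0ℓ 0ℓ) where
  open CommutativeRing R renaming (Carrier to F)
  open import Relation.Binary.Reasoning.Setoid setoid
  import Algebra.Properties.CommutativeSemiring.Exp commutativeSemiring as Exp
  import Algebra.Properties.CommutativeSemiring.Binomial commutativeSemiring as Binomial
  open import Algebra.Properties.Semiring.Mult semiring
    renaming (_×_ to _×ᵣ_) using (×-homo-1; ×-assoc-*; ×-assocˡ; ×-congʳ; ×1-homo-*)
  open import Algebra.Properties.Semiring.Sum semiring using (sum; sum-init-last; sum-cong-≋; sum-replicate-zero)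
  open import Algebra.Properties.Group +-group using (inverseʳ-unique)

  infixr 8 _^_
  _^_ : F → ℕ → F
  _^_ = pow R

  ^≡Exp^ : ∀ x n → x ^ n ≡ x Exp.^ n
  ^≡Exp^ x zero = ≡.refl
  ^≡Exp^ x (suc n) = ≡.cong (x *_) (^≡Exp^ x n)

  ^-congˡ : ∀ n {x y} → x ≈ y → x ^ n ≈ y ^ n
  ^-congˡ n {x} {y} rewrite ^≡Exp^ x n | ^≡Exp^ y n = Exp.^-congˡ n

  ^-distrib-* : ∀ x y n → (x * y) ^ n ≈ x ^ n * y ^ n
  ^-distrib-* x y n rewrite ^≡Exp^ (x * y) n | ^≡Exp^ x n | ^≡Exp^ y n = Exp.^-distrib-* x y n

  ^-assocʳ : ∀ x m n → (x ^ m) ^ n ≈ x ^ (m ℕ.* n)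
  ^-assocʳ x m n rewrite ^≡Exp^ x m | ^≡Exp^ (x Exp.^ m) n | ^≡Exp^ x (m ℕ.* n) = Exp.^-assocʳ x m n

  AdditiveExponent : ℕ → Set
  AdditiveExponent n = ∀ x y → (x + y) ^ n ≈ x ^ n + y ^ n

  1^n≈1 : ∀ n → 1# ^ n ≈ 1#
  1^n≈1 zero = refl
  1^n≈1 (suc n) = trans (*-identityˡ _) (1^n≈1 n)

  ×1-homo-^ : ∀ p k → (p ℕ.^ k) ×ᵣ 1# ≈ (p ×ᵣ 1#) ^ k
  ×1-homo-^ p zero = +-identityʳ 1#
  ×1-homo-^ p (suc k) = trans (×1-homo-* p (p ℕ.^ k)) (*-congˡ (×1-homo-^ p k))

  0^n≈0 : ∀ {n} → 1 ≤ n → 0# ^ n ≈ 0#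
  0^n≈0 {suc n} _ = zeroˡ _

  -‿^ : ∀ {n} → 1 ≤ n → AdditiveExponent n → ∀ x → (- x) ^ n ≈ - x ^ n
  -‿^ {n} 1≤n additive x = inverseʳ-unique (x ^ n) ((- x) ^ n) (begin
    x ^ n + (- x) ^ n ≈⟨ additive x (- x) ⟨
    (x - x) ^ n       ≈⟨ ^-congˡ n (-‿inverseʳ x) ⟩
    0# ^ n            ≈⟨ 0^n≈0 1≤n ⟩
    0#                ∎)

  p×x≈0 : ∀ {p} → p ×ᵣ 1# ≈ 0# → ∀ x → p ×ᵣ x ≈ 0#
  p×x≈0 {p} p×1≈0 x = begin
    p ×ᵣ x        ≈⟨ ×-congʳ p (*-identityˡ x) ⟨
    p ×ᵣ (1# * x) ≈⟨ ×-assoc-* p 1# x ⟨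
    (p ×ᵣ 1#) * x ≈⟨ *-congʳ p×1≈0 ⟩
    0# * x       ≈⟨ zeroˡ x ⟩
    0#           ∎

  ^p-additive : ∀ {p} → Prime p → p ×ᵣ 1# ≈ 0# → AdditiveExponent p
  ^p-additive {zero} p-prime = contradiction p-prime ¬prime[0]
  ^p-additive {p@(suc p₁)} p-prime p×1≈0 x y = begin
    (x + y) ^ p      ≡⟨ ^≡Exp^ (x + y) p ⟩
    (x + y) Exp.^ p  ≈⟨ Binomial.theorem p x y ⟩
    term 0 + sum {p} (λ k → term (suc (toℕ k)))
      ≈⟨ +-congˡ (sum-init-last {p₁} (λ k → term (suc (toℕ k)))) ⟩
    term 0 + (sum {p₁} (λ k → term (suc (toℕ (Fin.inject₁ k)))) + term (suc (toℕ (Fin.fromℕ p₁))))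
      ≈⟨ +-cong first (+-cong (trans (sum-cong-≋ {p₁} middle) (sum-replicate-zero p₁)) last) ⟩
    y ^ p + (0# + x ^ p) ≈⟨ +-comm _ _ ⟩
    (0# + x ^ p) + y ^ p ≈⟨ +-congʳ (+-identityˡ _) ⟩
    x ^ p + y ^ p        ∎
    where
    term : ℕ → F
    term k = (p C k) ×ᵣ (x Exp.^ k * y Exp.^ (p ℕ.∸ k))
    first : term 0 ≈ y ^ p
    first = begin
      1 ×ᵣ (1# * y Exp.^ p) ≈⟨ ×-homo-1 _ ⟩
      1# * y Exp.^ p       ≈⟨ *-identityˡ _ ⟩
      y Exp.^ p            ≡⟨ ^≡Exp^ y p ⟨
      y ^ p                ∎
    last : term (suc (toℕ (Fin.fromℕ p₁))) ≈ x ^ p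
    last rewrite Fin.toℕ-fromℕ p₁ | nCn≡1 p | ℕ.n∸n≡0 p = begin
      1 ×ᵣ (x Exp.^ p * 1#) ≈⟨ ×-homo-1 _ ⟩
      x Exp.^ p * 1#       ≈⟨ *-identityʳ _ ⟩
      x Exp.^ p            ≡⟨ ^≡Exp^ x p ⟨
      x ^ p                ∎
    middle : ∀ k → term (suc (toℕ (Fin.inject₁ k))) ≈ 0#
    middle k with p∣pCk p-prime (s≤s z≤n) (s≤s (Fin.inject₁ℕ< k))
    ... | divides c pCk≡c*p = begin
      (p C j) ×ᵣ z    ≡⟨ ≡.cong (_×ᵣ z) (≡.trans pCk≡c*p (ℕ.*-comm c p)) ⟩
      (p ℕ.* c) ×ᵣ z  ≈⟨ ×-assocˡ z p c ⟨
      p ×ᵣ (c ×ᵣ z)    ≈⟨ p×x≈0 {p} p×1≈0 (c ×ᵣ z) ⟩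
      0#             ∎
      where
      j : ℕ
      j = suc (toℕ (Fin.inject₁ k))
      z : F
      z = x Exp.^ j * y Exp.^ (p ℕ.∸ j)

  ^p^k-additive : ∀ {p} → Prime p → p ×ᵣ 1# ≈ 0# → ∀ k → AdditiveExponent (p ℕ.^ k)
  ^p^k-additive _ _ zero x y = distribʳ 1# x y
  ^p^k-additive {p} p-prime p×1≈0 (suc k) x y = begin
    (x + y) ^ (p ℕ.* p^k)               ≈⟨ ^-assocʳ (x + y) p p^k ⟨
    ((x + y) ^ p) ^ p^k                 ≈⟨ ^-congˡ p^k (^p-additive p-prime p×1≈0 x y) ⟩
    (x ^ p + y ^ p) ^ p^k               ≈⟨ ^p^k-additive p-prime p×1≈0 k (x ^ p) (y ^ p) ⟩
    (x ^ p) ^ p^k + (y ^ p) ^ p^k       ≈⟨ +-cong (^-assocʳ x p p^k) (^-assocʳ y p p^k) ⟩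
    x ^ (p ℕ.* p^k) + y ^ (p ℕ.* p^k)   ∎
    where
    p^k : ℕ
    p^k = p ℕ.^ k

module Field (R : CommutativeRing 0ℓ 0ℓ) (isField : IsField R) where
  open CommutativeRing R renaming (Carrier to F)
  open import Relation.Binary.Reasoning.Setoid setoid
  open import Algebra.Properties.Ring ring using (x[y-z]≈xy-xz)
  open import Algebra.Properties.Group +-group using (x∙y⁻¹≈ε⇒x≈y; x≈y⇒x∙y⁻¹≈ε)
  open Powers R

  1≉0 : 1# ≉ 0#
  1≉0 = proj₁ isField

  inverse : ∀ x → x ≉ 0# → F
  inverse x x≉0 = proj₁ (proj₂ isField x x≉0)

  x*x⁻¹≈1 : ∀ x (x≉0 : x ≉ 0#) → x * inverse x x≉0 ≈ 1#
  x*x⁻¹≈1 x x≉0 = proj₂ (proj₂ isField x x≉0)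

  x⁻¹*x≈1 : ∀ x (x≉0 : x ≉ 0#) → inverse x x≉0 * x ≈ 1#
  x⁻¹*x≈1 x x≉0 = trans (*-comm _ x) (x*x⁻¹≈1 x x≉0)

  x*y≈0⇒y≈0 : ∀ {x y} → x ≉ 0# → x * y ≈ 0# → y ≈ 0#
  x*y≈0⇒y≈0 {x} {y} x≉0 xy≈0 = begin
    y                       ≈⟨ *-identityˡ y ⟨
    1# * y                  ≈⟨ *-congʳ (x⁻¹*x≈1 x x≉0) ⟨
    inverse x x≉0 * x * y   ≈⟨ *-assoc _ x y ⟩
    inverse x x≉0 * (x * y) ≈⟨ *-congˡ xy≈0 ⟩
    inverse x x≉0 * 0#      ≈⟨ zeroʳ _ ⟩
    0#                      ∎

  *-nonzero : ∀ {x y} → x ≉ 0# → y ≉ 0# → x * y ≉ 0#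
  *-nonzero x≉0 y≉0 xy≈0 = y≉0 (x*y≈0⇒y≈0 x≉0 xy≈0)

  ^-nonzero : ∀ n {x} → x ≉ 0# → x ^ n ≉ 0#
  ^-nonzero zero    _   = 1≉0
  ^-nonzero (suc n) x≉0 = *-nonzero x≉0 (^-nonzero n x≉0)

  x*[x⁻¹*y]≈y : ∀ {x} (x≉0 : x ≉ 0#) y → x * (inverse x x≉0 * y) ≈ y
  x*[x⁻¹*y]≈y {x} x≉0 y = trans (sym (*-assoc _ _ y)) (trans (*-congʳ (x*x⁻¹≈1 x x≉0)) (*-identityˡ y))

  x⁻¹*[x*y]≈y : ∀ {x} (x≉0 : x ≉ 0#) y → inverse x x≉0 * (x * y) ≈ y
  x⁻¹*[x*y]≈y {x} x≉0 y = trans (sym (*-assoc _ _ y)) (trans (*-congʳ (x⁻¹*x≈1 x x≉0)) (*-identityˡ y))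

  *-cancelʳ-nonzero : ∀ {x y z} → z ≉ 0# → x * z ≈ y * z → x ≈ y
  *-cancelʳ-nonzero {x} {y} {z} z≉0 xz≈yz = x∙y⁻¹≈ε⇒x≈y x y (x*y≈0⇒y≈0 z≉0 (begin
    z * (x - y)   ≈⟨ x[y-z]≈xy-xz z x y ⟩
    z * x - z * y ≈⟨ x≈y⇒x∙y⁻¹≈ε (trans (*-comm z x) (trans xz≈yz (*-comm y z))) ⟩
    0#            ∎))

module Polynomials (R : CommutativeRing 0ℓ 0ℓ) (isField : IsField R) where
  open CommutativeRing R renaming (Carrier to F)
  open import Relation.Binary.Reasoning.Setoid setoid
  open import Algebra.Properties.Ring ring using (x[y-z]≈xy-xz; [y-z]x≈yx-zx)
  open import Algebra.Properties.Group +-group using (x∙y⁻¹≈ε⇒x≈y)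
  open import Algebra.Properties.CommutativeSemigroup +-commutativeSemigroup using (interchange)
  open import Algebra.Properties.CommutativeSemigroup *-commutativeSemigroup using (x∙yz≈y∙xz)
  open import Algebra.Properties.AbelianGroup +-abelianGroup using (⁻¹-∙-comm)
  open Powers R
  open Field R isField

  -- Polynomial functions in Horner form: Poly< d f means deg f < d, Monic d f means f is monic of degree d.
  Poly< : ℕ → (F → F) → Set
  Poly< zero    f = ∀ x → f x ≈ 0#
  Poly< (suc d) f = ∃₂ λ c g → Poly< d g × (∀ x → f x ≈ c + x * g x)

  Monic : ℕ → (F → F) → Set
  Monic zero    f = ∀ x → f x ≈ 1#
  Monic (suc d) f = ∃₂ λ c g → Monic d g × (∀ x → f x ≈ c + x * g x)

  Poly<-resp : ∀ {d f f′} → Poly< d f → (∀ x → f′ x ≈ f x) → Poly< d f′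
  Poly<-resp {zero}  f≈0              f′≈f x = trans (f′≈f x) (f≈0 x)
  Poly<-resp {suc d} (c , g , pg , f≈) f′≈f = c , g , pg , λ x → trans (f′≈f x) (f≈ x)

  Monic-resp : ∀ {d f f′} → Monic d f → (∀ x → f′ x ≈ f x) → Monic d f′
  Monic-resp {zero}  f≈1              f′≈f x = trans (f′≈f x) (f≈1 x)
  Monic-resp {suc d} (c , g , mg , f≈) f′≈f = c , g , mg , λ x → trans (f′≈f x) (f≈ x)

  Poly<-zero : ∀ d → Poly< d (λ _ → 0#)
  Poly<-zero zero    _ = refl
  Poly<-zero (suc d)   = 0# , (λ _ → 0#) , Poly<-zero d , λ x → sym (trans (+-identityˡ _) (zeroʳ x))

  Poly<-mono : ∀ {d d′ f} → d ≤ d′ → Poly< d f → Poly< d′ f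
  Poly<-mono {zero}  z≤n       f≈0              = Poly<-resp (Poly<-zero _) f≈0
  Poly<-mono {suc d} (s≤s d≤d′) (c , g , pg , f≈) = c , g , Poly<-mono d≤d′ pg , f≈

  Monic⇒Poly< : ∀ {d f} → Monic d f → Poly< (suc d) f
  Monic⇒Poly< {zero}  f≈1 =
    1# , (λ _ → 0#) , (λ _ → refl) , λ x → trans (f≈1 x) (sym (trans (+-congˡ (zeroʳ x)) (+-identityʳ 1#)))
  Monic⇒Poly< {suc d} (c , g , mg , f≈) = c , g , Monic⇒Poly< mg , f≈

  Monic-+-Poly< : ∀ {d f g} → Monic d f → Poly< d g → Monic d (λ x → f x + g x)
  Monic-+-Poly< {zero}  f≈1 g≈0 x = trans (+-cong (f≈1 x) (g≈0 x)) (+-identityʳ 1#)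
  Monic-+-Poly< {suc d} (c , f′ , mf′ , f≈) (c′ , g′ , pg′ , g≈) =
    c + c′ , (λ x → f′ x + g′ x) , Monic-+-Poly< mf′ pg′ ,
    λ x → trans (+-cong (f≈ x) (g≈ x)) (trans (interchange c _ c′ _) (+-congˡ (sym (distribˡ x _ _))))

  Monic-^ : ∀ d → Monic d (_^ d)
  Monic-^ zero    _ = refl
  Monic-^ (suc d)   = 0# , _^ d , Monic-^ d , λ x → sym (+-identityˡ _)

  Horner-difference : ∀ (f g : F → F) {c} → (∀ x → f x ≈ c + x * g x) → ∀ x a → f x - f a ≈ x * g x - a * g a
  Horner-difference f g {c} f≈ x a = begin
    f x - f a                         ≈⟨ +-cong (f≈ x) (-‿cong (f≈ a)) ⟩
    (c + x * g x) - (c + a * g a)     ≈⟨ +-congˡ (⁻¹-∙-comm c (a * g a)) ⟨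
    (c + x * g x) + (- c - a * g a)   ≈⟨ interchange c _ (- c) _ ⟩
    (c - c) + (x * g x - a * g a)     ≈⟨ +-congʳ (-‿inverseʳ c) ⟩
    0# + (x * g x - a * g a)          ≈⟨ +-identityˡ _ ⟩
    x * g x - a * g a                 ∎

  [u-v]+[v-w]≈u-w : ∀ u v w → (u - v) + (v - w) ≈ u - w
  [u-v]+[v-w]≈u-w u v w = begin
    (u - v) + (v - w)   ≈⟨ +-assoc u (- v) _ ⟩
    u + (- v + (v - w)) ≈⟨ +-congˡ (+-assoc (- v) v (- w)) ⟨
    u + ((- v + v) - w) ≈⟨ +-congˡ (+-congʳ (-‿inverseˡ v)) ⟩
    u + (0# - w)        ≈⟨ +-congˡ (+-identityˡ (- w)) ⟩
    u - w               ∎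

  x*u-a*v≈[x-a]*[v+x*w] : ∀ x a u v w → u - v ≈ (x - a) * w → x * u - a * v ≈ (x - a) * (v + x * w)
  x*u-a*v≈[x-a]*[v+x*w] x a u v w u-v≈[x-a]w = begin
    x * u - a * v                       ≈⟨ [u-v]+[v-w]≈u-w (x * u) (x * v) (a * v) ⟨
    (x * u - x * v) + (x * v - a * v)   ≈⟨ +-cong (x[y-z]≈xy-xz x u v) ([y-z]x≈yx-zx v x a) ⟨
    x * (u - v) + (x - a) * v           ≈⟨ +-congʳ (*-congˡ u-v≈[x-a]w) ⟩
    x * ((x - a) * w) + (x - a) * v     ≈⟨ +-congʳ (x∙yz≈y∙xz x (x - a) w) ⟩
    (x - a) * (x * w) + (x - a) * v     ≈⟨ +-comm _ _ ⟩
    (x - a) * v + (x - a) * (x * w)     ≈⟨ distribˡ (x - a) v (x * w) ⟨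
    (x - a) * (v + x * w)               ∎

  Monic-factor : ∀ {d f} → Monic (suc d) f → ∀ a → ∃ λ h → Monic d h × (∀ x → f x - f a ≈ (x - a) * h x)
  Monic-factor {zero} {f} (c , g , g≈1 , f≈) a = (λ _ → 1#) , (λ _ → refl) , λ x → begin
    f x - f a         ≈⟨ Horner-difference f g f≈ x a ⟩
    x * g x - a * g a ≈⟨ +-cong (*-congˡ (g≈1 x)) (-‿cong (*-congˡ (g≈1 a))) ⟩
    x * 1# - a * 1#   ≈⟨ [y-z]x≈yx-zx 1# x a ⟨
    (x - a) * 1#      ∎
  Monic-factor {suc d} {f} (c , g , mg , f≈) a with Monic-factor mg a
  ... | h , mh , g-g≈ = (λ x → g a + x * h x) , (g a , h , mh , λ _ → refl) , λ x → begin
    f x - f a                 ≈⟨ Horner-difference f g f≈ x a ⟩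
    x * g x - a * g a         ≈⟨ x*u-a*v≈[x-a]*[v+x*w] x a (g x) (g a) (h x) (g-g≈ x) ⟩
    (x - a) * (g a + x * h x) ∎

  Monic-roots≤degree : ∀ {d f t} → Monic d f → (r : Fin t → F) → Injective _≡_ _≈_ r →
                       (∀ i → f (r i) ≈ 0#) → t ≤ d
  Monic-roots≤degree {t = zero} _ _ _ _ = z≤n
  Monic-roots≤degree {zero} {t = suc t} f≈1 r _ root = contradiction (trans (sym (f≈1 (r Fin.zero))) (root Fin.zero)) 1≉0
  Monic-roots≤degree {suc d} {f} {suc t} mf r r-inj root with Monic-factor mf (r Fin.zero)
  ... | h , mh , f-f≈ = s≤s (Monic-roots≤degree mh (r ∘ Fin.suc) (Fin.suc-injective ∘ r-inj) h-root)
    where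
    h-root : ∀ i → h (r (Fin.suc i)) ≈ 0#
    h-root i = x*y≈0⇒y≈0 (λ r≈r₀ → Fin.0≢1+n (≡.sym (r-inj (x∙y⁻¹≈ε⇒x≈y _ _ r≈r₀)))) (begin
      (r (Fin.suc i) - r Fin.zero) * h (r (Fin.suc i)) ≈⟨ f-f≈ _ ⟨
      f (r (Fin.suc i)) - f (r Fin.zero)                ≈⟨ +-cong (root _) (-‿cong (root _)) ⟩
      0# - 0#                                           ≈⟨ -‿inverseʳ 0# ⟩
      0#                                                ∎)

  geometric : F → ℕ → F
  geometric y zero    = 0#
  geometric y (suc k) = y ^ k + geometric y k

  [y-1]*geometric≈y^k-1 : ∀ y k → (y - 1#) * geometric y k ≈ y ^ k - 1#
  [y-1]*geometric≈y^k-1 y zero    = trans (zeroʳ _) (sym (-‿inverseʳ 1#))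
  [y-1]*geometric≈y^k-1 y (suc k) = begin
    (y - 1#) * (y ^ k + geometric y k)                 ≈⟨ distribˡ _ _ _ ⟩
    (y - 1#) * y ^ k + (y - 1#) * geometric y k        ≈⟨ +-cong ([y-z]x≈yx-zx (y ^ k) y 1#) ([y-1]*geometric≈y^k-1 y k) ⟩
    (y * y ^ k - 1# * y ^ k) + (y ^ k - 1#)            ≈⟨ +-congʳ (+-congˡ (-‿cong (*-identityˡ _))) ⟩
    (y ^ suc k - y ^ k) + (y ^ k - 1#)                 ≈⟨ [u-v]+[v-w]≈u-w _ _ _ ⟩
    y ^ suc k - 1#                                     ∎

module FiniteField (R : CommutativeRing 0ℓ 0ℓ) (isField : IsField R) {N : ℕ} (size : HasSize R N) where
  open CommutativeRing R renaming (Carrier to F)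
  open import Relation.Binary.Reasoning.Setoid setoid
  open import Algebra.Properties.Semiring.Mult semiring renaming (_×_ to _×ᵣ_) using ()
  import Algebra.Properties.CommutativeMonoid.Sum as Sum
  open import Algebra.Properties.Group +-group using (identityʳ-unique; //-rightDividesˡ; //-rightDividesʳ)
  open Powers R
  open Field R isField
  open Inverse size using (to; from; from-cong; strictlyInverseˡ; strictlyInverseʳ)

  to-injective : ∀ {i j} → to i ≈ to j → i ≡ j
  to-injective {i} {j} eq = ≡.trans (≡.sym (strictlyInverseʳ i)) (≡.trans (from-cong eq) (strictlyInverseʳ j))

  from-injective : ∀ {x y} → from x ≡ from y → x ≈ y
  from-injective {x} {y} eq = trans (sym (strictlyInverseˡ x)) (trans (reflexive (≡.cong to eq)) (strictlyInverseˡ y))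

  infix 4 _≟_
  _≟_ : (x y : F) → Dec (x ≈ y)
  x ≟ y = Dec.map′ from-injective from-cong (from x Fin.≟ from y)

  ^≈0⇒≈0 : ∀ n {x} → x ^ n ≈ 0# → x ≈ 0#
  ^≈0⇒≈0 n {x} xⁿ≈0 = Dec.decidable-stable (x ≟ 0#) (λ x≉0 → ^-nonzero n x≉0 xⁿ≈0)

  1≤N : 1 ≤ N
  1≤N = Fin⇒1≤ (from 0#)
    where
    Fin⇒1≤ : ∀ {n} → Fin n → 1 ≤ n
    Fin⇒1≤ {suc n} _ = s≤s z≤n

  module Reindexing (M : CommutativeMonoid 0ℓ 0ℓ) where
    open CommutativeMonoid M using () renaming (Carrier to A; _≈_ to _≈ᴬ_; trans to transᴬ)
    open Sum M using (sum; sum-permute; sum-cong-≋)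

    sum-bijection : (f : F → A) → (∀ {y z} → y ≈ z → f y ≈ᴬ f z) →
                    (φ ψ : F → F) → (∀ {y z} → y ≈ z → φ y ≈ φ z) → (∀ {y z} → y ≈ z → ψ y ≈ ψ z) →
                    (∀ y → φ (ψ y) ≈ y) → (∀ y → ψ (φ y) ≈ y) →
                    sum (f ∘ to) ≈ᴬ sum (f ∘ φ ∘ to)
    sum-bijection f f-cong φ ψ φ-cong ψ-cong φψ≈id ψφ≈id =
      transᴬ (sum-permute (f ∘ to) π) (sum-cong-≋ (λ j → f-cong (strictlyInverseˡ (φ (to j)))))
      where
      π : Permutation′ N
      π = permutation (from ∘ φ ∘ to) (from ∘ ψ ∘ to)
            (λ j → to-injective (trans (strictlyInverseˡ _) (trans (φ-cong (strictlyInverseˡ _)) (φψ≈id (to j)))))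
            (λ j → to-injective (trans (strictlyInverseˡ _) (trans (ψ-cong (strictlyInverseˡ _)) (ψφ≈id (to j)))))

  product : ∀ {n} → (Fin n → F) → F
  product = Sum.sum *-commutativeMonoid

  product-nonzero : ∀ {n} (f : Fin n → F) → (∀ j → f j ≉ 0#) → product f ≉ 0#
  product-nonzero {zero}  f f≉0 = 1≉0
  product-nonzero {suc n} f f≉0 = *-nonzero (f≉0 Fin.zero) (product-nonzero (f ∘ Fin.suc) (f≉0 ∘ Fin.suc))

  N×x≈0 : ∀ x → N ×ᵣ x ≈ 0#
  N×x≈0 x = identityʳ-unique Σ (N ×ᵣ x) (begin
    Σ + N ×ᵣ x               ≈⟨ +-congˡ (sum-replicate N) ⟨
    Σ + sum {N} (λ _ → x)    ≈⟨ ∑-distrib-+ {N} to (λ _ → x) ⟨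
    sum (λ j → to j + x)
      ≈⟨ sum-bijection id id (_+ x) (_- x) +-congʳ +-congʳ (//-rightDividesˡ x) (//-rightDividesʳ x) ⟨
    Σ                        ∎)
    where
    open Sum +-commutativeMonoid using (sum; sum-replicate; ∑-distrib-+)
    open Reindexing +-commutativeMonoid
    Σ : F
    Σ = sum to

  zero↦one : F → F
  zero↦one y with y ≟ 0#
  ... | yes _ = 1#
  ... | no  _ = y

  zero↦one-nonzero : ∀ y → zero↦one y ≉ 0#
  zero↦one-nonzero y with y ≟ 0#
  ... | yes _   = 1≉0
  ... | no  y≉0 = y≉0

  zero↦one-cong : ∀ {y z} → y ≈ z → zero↦one y ≈ zero↦one z
  zero↦one-cong {y} {z} y≈z with y ≟ 0# | z ≟ 0#
  ... | yes _   | yes _   = refl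
  ... | yes y≈0 | no  z≉0 = contradiction (trans (sym y≈z) y≈0) z≉0
  ... | no  y≉0 | yes z≈0 = contradiction (trans y≈z z≈0) y≉0
  ... | no  _   | no  _   = y≈z

  x-at-0 : F → F → F
  x-at-0 x y with y ≟ 0#
  ... | yes _ = x
  ... | no  _ = 1#

  zero↦one-* : ∀ {x} → x ≉ 0# → ∀ y → zero↦one (x * y) * x-at-0 x y ≈ x * zero↦one y
  zero↦one-* {x} x≉0 y with y ≟ 0# | (x * y) ≟ 0#
  ... | yes _   | yes _    = *-comm 1# x
  ... | yes y≈0 | no  xy≉0 = contradiction (trans (*-congˡ y≈0) (zeroʳ x)) xy≉0
  ... | no  y≉0 | yes xy≈0 = contradiction xy≈0 (*-nonzero x≉0 y≉0)
  ... | no  _   | no  _    = *-identityʳ (x * y)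

  product-supported-at : ∀ {n} (f : Fin n → F) j₀ → (∀ j → j ≢ j₀ → f j ≈ 1#) → product f ≈ f j₀
  product-supported-at {suc n} f Fin.zero f≈1 =
    trans (*-congˡ (trans (sum-cong-≋ {n} (λ j → f≈1 (Fin.suc j) λ ())) (sum-replicate-zero n))) (*-identityʳ _)
    where open Sum *-commutativeMonoid using (sum-cong-≋; sum-replicate-zero)
  product-supported-at f (Fin.suc j₀) f≈1 =
    trans (*-congʳ (f≈1 Fin.zero λ ()))
          (trans (*-identityˡ _) (product-supported-at (f ∘ Fin.suc) j₀
                                    (λ j j≢j₀ → f≈1 (Fin.suc j) (j≢j₀ ∘ Fin.suc-injective))))

  -- Multiplication by x ≉ 0 permutes F; zero↦one makes the product over F nonzero, and the single
  -- factor left unscaled (at 0) is restored by x-at-0.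
  fermat : ∀ x → x ^ N ≈ x
  fermat x with x ≟ 0#
  ... | yes x≈0 = trans (^-congˡ N x≈0) (trans (0^n≈0 1≤N) (sym x≈0))
  ... | no  x≉0 = sym (*-cancelʳ-nonzero (product-nonzero (zero↦one ∘ to) (zero↦one-nonzero ∘ to)) (begin
    x * P                                                  ≈⟨ *-comm x P ⟩
    P * x                                                  ≈⟨ *-cong P≈∏[zero↦one[x*y]] (sym ∏x-at-0≈x) ⟩
    product (zero↦one ∘ (x *_) ∘ to) * product (x-at-0 x ∘ to) ≈⟨ ∑-distrib-+ {N} _ _ ⟨
    product (λ j → zero↦one (x * to j) * x-at-0 x (to j))  ≈⟨ sum-cong-≋ {N} (zero↦one-* x≉0 ∘ to) ⟩
    product (λ j → x * zero↦one (to j))                    ≈⟨ ∑-distrib-+ {N} _ _ ⟩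
    product {N} (λ _ → x) * P                              ≈⟨ *-congʳ ∏x≈x^N ⟩
    x ^ N * P                                              ∎))
    where
    open Sum *-commutativeMonoid using (sum-cong-≋; sum-replicate; ∑-distrib-+)
    open Reindexing *-commutativeMonoid
    P : F
    P = product (zero↦one ∘ to)
    P≈∏[zero↦one[x*y]] : P ≈ product (zero↦one ∘ (x *_) ∘ to)
    P≈∏[zero↦one[x*y]] = sum-bijection zero↦one zero↦one-cong (x *_) (inverse x x≉0 *_) *-congˡ *-congˡ
                                        (x*[x⁻¹*y]≈y x≉0) (x⁻¹*[x*y]≈y x≉0)
    ∏x≈x^N : product {N} (λ _ → x) ≈ x ^ N
    ∏x≈x^N = trans (sum-replicate N) (reflexive (≡.sym (^≡Exp^ x N)))
    ∏x-at-0≈x : product (x-at-0 x ∘ to) ≈ x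
    ∏x-at-0≈x = trans (product-supported-at _ (from 0#) at-nonzero) at-0
      where
      at-0 : x-at-0 x (to (from 0#)) ≈ x
      at-0 with to (from 0#) ≟ 0#
      ... | yes _   = refl
      ... | no  ≉0 = contradiction (strictlyInverseˡ 0#) ≉0
      at-nonzero : ∀ j → j ≢ from 0# → x-at-0 x (to j) ≈ 1#
      at-nonzero j j≢ with to j ≟ 0#
      ... | yes ≈0 = contradiction (≡.trans (≡.sym (strictlyInverseʳ j)) (from-cong ≈0)) j≢
      ... | no  _  = refl

  N≡p^k⇒p×1≈0 : ∀ {p k} → N ≡ p ℕ.^ k → p ×ᵣ 1# ≈ 0#
  N≡p^k⇒p×1≈0 {p} {k} N≡p^k = ^≈0⇒≈0 k (begin
    (p ×ᵣ 1#) ^ k   ≈⟨ ×1-homo-^ p k ⟨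
    (p ℕ.^ k) ×ᵣ 1# ≡⟨ ≡.cong (_×ᵣ 1#) N≡p^k ⟨
    N ×ᵣ 1#         ≈⟨ N×x≈0 1# ⟩
    0#              ∎)

module Vectors (R : CommutativeRing 0ℓ 0ℓ) where
  open CommutativeRing R renaming (Carrier to F)
  open import Relation.Binary.Reasoning.Setoid setoid
  open import Algebra.Properties.Ring ring using ([y-z]x≈yx-zx; -‿distribˡ-*; -‿distribʳ-*)
  open import Algebra.Properties.Group +-group using (x∙y⁻¹≈ε⇒x≈y; x≈y⇒x∙y⁻¹≈ε; inverseˡ-unique)
  open import Algebra.Properties.CommutativeSemigroup +-commutativeSemigroup using (interchange)
  open import Algebra.Properties.AbelianGroup +-abelianGroup using (⁻¹-∙-comm)
  open import Data.Vec.Relation.Binary.Equality.Setoid setoid public using (≋-refl; ≋-sym; ≋-trans)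

  infix 4 _≋_
  infixl 6 _⊕_
  infixr 7 _·_

  _≋_ : ∀ {n} → Vec F n → Vec F n → Set
  _≋_ = D._≋_ R

  _⊕_ : ∀ {n} → Vec F n → Vec F n → Vec F n
  _⊕_ = D._⊕_ R

  _·_ : ∀ {n} → F → Vec F n → Vec F n
  _·_ = D._·_ R

  0v : ∀ {n} → Vec F n
  0v = D.0v R

  comb : ∀ {n d} → Vec F d → Vec (Vec F n) d → Vec F n
  comb = D.comb R

  ≡⇒≋ : ∀ {n} {v w : Vec F n} → v ≡ w → v ≋ w
  ≡⇒≋ ≡.refl = ≋-refl

  ⊕-cong : ∀ {n} {v v′ w w′ : Vec F n} → v ≋ v′ → w ≋ w′ → v ⊕ w ≋ v′ ⊕ w′
  ⊕-cong = Pointwise.zipWith-cong +-cong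

  ·-cong : ∀ {n c c′} {v v′ : Vec F n} → c ≈ c′ → v ≋ v′ → c · v ≋ c′ · v′
  ·-cong c≈c′ = Pointwise.map⁺ (*-cong c≈c′)

  ⊕-identityˡ : ∀ {n} (v : Vec F n) → 0v ⊕ v ≋ v
  ⊕-identityˡ = Pointwise.zipWith-identityˡ +-identityˡ

  ⊕-identityʳ : ∀ {n} (v : Vec F n) → v ⊕ 0v ≋ v
  ⊕-identityʳ = Pointwise.zipWith-identityʳ +-identityʳ

  ⊕-assoc : ∀ {n} (u v w : Vec F n) → (u ⊕ v) ⊕ w ≋ u ⊕ (v ⊕ w)
  ⊕-assoc = Pointwise.zipWith-assoc +-assoc

  ·-distribˡ : ∀ {n} c (v w : Vec F n) → c · (v ⊕ w) ≋ c · v ⊕ c · w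
  ·-distribˡ c []       []       = []
  ·-distribˡ c (x ∷ v) (y ∷ w) = distribˡ c x y ∷ ·-distribˡ c v w

  ·-distribʳ : ∀ {n} c d (v : Vec F n) → (c + d) · v ≋ c · v ⊕ d · v
  ·-distribʳ c d []      = []
  ·-distribʳ c d (x ∷ v) = distribʳ x c d ∷ ·-distribʳ c d v

  ·-assoc : ∀ {n} c d (v : Vec F n) → c · (d · v) ≋ (c * d) · v
  ·-assoc c d []      = []
  ·-assoc c d (x ∷ v) = sym (*-assoc c d x) ∷ ·-assoc c d v

  ·-identityˡ : ∀ {n} (v : Vec F n) → 1# · v ≋ v
  ·-identityˡ []      = []
  ·-identityˡ (x ∷ v) = *-identityˡ x ∷ ·-identityˡ v

  ·-zeroˡ : ∀ {n} (v : Vec F n) → 0# · v ≋ 0v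
  ·-zeroˡ []      = []
  ·-zeroˡ (x ∷ v) = zeroˡ x ∷ ·-zeroˡ v

  ·-zeroʳ : ∀ {n} c → c · 0v {n} ≋ 0v
  ·-zeroʳ {zero}  c = []
  ·-zeroʳ {suc n} c = zeroʳ c ∷ ·-zeroʳ c

  0v-++ : ∀ m n → 0v {m ℕ.+ n} ≡ 0v {m} ++ 0v {n}
  0v-++ zero    n = ≡.refl
  0v-++ (suc m) n = ≡.cong (0# ∷_) (0v-++ m n)

  All≈0⇒≋0 : ∀ {n} {v : Vec F n} → All (_≈ 0#) v → v ≋ 0v
  All≈0⇒≋0 []            = []
  All≈0⇒≋0 (x≈0 ∷ v≈0) = x≈0 ∷ All≈0⇒≋0 v≈0

  c·v≋0⇒v≋0 : ∀ {n c c′} {v : Vec F n} → c′ * c ≈ 1# → c · v ≋ 0v → v ≋ 0v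
  c·v≋0⇒v≋0 {c = c} {c′} {v} c′c≈1 cv≋0 =
    ≋-trans (≋-sym (·-identityˡ v)) (≋-trans (·-cong (sym c′c≈1) ≋-refl)
      (≋-trans (≋-sym (·-assoc c′ c v)) (≋-trans (·-cong refl cv≋0) (·-zeroʳ c′))))

  comb-congˡ : ∀ {n d} {a a′ : Vec F d} (b : Vec (Vec F n) d) → a ≋ a′ → comb a b ≋ comb a′ b
  comb-congˡ []      []            = ≋-refl
  comb-congˡ (_ ∷ b) (c≈c′ ∷ a≈a′) = ⊕-cong (·-cong c≈c′ ≋-refl) (comb-congˡ b a≈a′)

  comb-replicate-0 : ∀ {n d} (b : Vec (Vec F n) d) → comb (replicate d 0#) b ≋ 0v
  comb-replicate-0 []      = ≋-refl
  comb-replicate-0 (v ∷ b) = ≋-trans (⊕-cong (·-zeroˡ v) (comb-replicate-0 b)) (⊕-identityˡ 0v)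

  comb-e₀ : ∀ {n d} (v : Vec F n) (b : Vec (Vec F n) d) → comb (1# ∷ replicate d 0#) (v ∷ b) ≋ v
  comb-e₀ v b = ≋-trans (⊕-cong (·-identityˡ v) (comb-replicate-0 b)) (⊕-identityʳ v)

  comb-0∷ : ∀ {n d} (a : Vec F d) (v : Vec F n) (b : Vec (Vec F n) d) → comb (0# ∷ a) (v ∷ b) ≋ comb a b
  comb-0∷ a v b = ≋-trans (⊕-cong (·-zeroˡ v) ≋-refl) (⊕-identityˡ _)

  comb-++ : ∀ {n d₁ d₂} (a₁ : Vec F d₁) (a₂ : Vec F d₂) (b₁ : Vec (Vec F n) d₁) (b₂ : Vec (Vec F n) d₂) →
            comb (a₁ ++ a₂) (b₁ ++ b₂) ≋ comb a₁ b₁ ⊕ comb a₂ b₂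
  comb-++ []       a₂ []       b₂ = ≋-sym (⊕-identityˡ _)
  comb-++ (c ∷ a₁) a₂ (v ∷ b₁) b₂ = ≋-trans (⊕-cong ≋-refl (comb-++ a₁ a₂ b₁ b₂)) (≋-sym (⊕-assoc _ _ _))

  comb-scale : ∀ {n d} c (a : Vec F d) (b : Vec (Vec F n) d) → comb (map (c *_) a) b ≋ c · comb a b
  comb-scale c []      []      = ≋-sym (·-zeroʳ c)
  comb-scale c (x ∷ a) (v ∷ b) = ≋-trans (⊕-cong (≋-sym (·-assoc c x v)) (comb-scale c a b)) (≋-sym (·-distribˡ c _ _))

  comb-[_] : ∀ {n} c (v : Vec F n) → comb (c ∷ []) (v ∷ []) ≋ c · v
  comb-[ c ] v = ⊕-identityʳ (c · v)

  infixl 6 _⊖_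
  _⊖_ : ∀ {n} → Vec F n → Vec F n → Vec F n
  _⊖_ = zipWith _-_

  ⊖-≋0 : ∀ {n} {v w : Vec F n} → v ≋ w → v ⊖ w ≋ 0v
  ⊖-≋0 []           = []
  ⊖-≋0 (x≈y ∷ v≋w) = x≈y⇒x∙y⁻¹≈ε x≈y ∷ ⊖-≋0 v≋w

  ⊖≈0⇒≋ : ∀ {n} (v w : Vec F n) → All (_≈ 0#) (v ⊖ w) → v ≋ w
  ⊖≈0⇒≋ []      []      []              = []
  ⊖≈0⇒≋ (x ∷ v) (y ∷ w) (x-y≈0 ∷ v-w≈0) = x∙y⁻¹≈ε⇒x≈y x y x-y≈0 ∷ ⊖≈0⇒≋ v w v-w≈0

  comb-⊖ : ∀ {n d} (a a′ : Vec F d) (b : Vec (Vec F n) d) → comb (a ⊖ a′) b ≋ comb a b ⊖ comb a′ b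
  comb-⊖ []      []       []      = ≋-sym (⊖-≋0 ≋-refl)
  comb-⊖ (x ∷ a) (x′ ∷ a′) (v ∷ b) =
    ≋-trans (⊕-cong (·-distrib-⊖ x x′ v) (comb-⊖ a a′ b)) (⊖-⊕-interchange _ _ _ _)
    where
    ·-distrib-⊖ : ∀ {n} x x′ (v : Vec F n) → (x - x′) · v ≋ x · v ⊖ x′ · v
    ·-distrib-⊖ x x′ []      = []
    ·-distrib-⊖ x x′ (y ∷ v) = [y-z]x≈yx-zx y x x′ ∷ ·-distrib-⊖ x x′ v
    ⊖-⊕-interchange : ∀ {n} (u v w z : Vec F n) → (u ⊖ v) ⊕ (w ⊖ z) ≋ (u ⊕ w) ⊖ (v ⊕ z)
    ⊖-⊕-interchange []      []      []      []      = []
    ⊖-⊕-interchange (x ∷ u) (y ∷ v) (x′ ∷ w) (y′ ∷ z) =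
      trans (interchange x (- y) x′ (- y′)) (+-congˡ (⁻¹-∙-comm y y′)) ∷ ⊖-⊕-interchange u v w z

  c*x+y≈0⇒x≈-c′*y : ∀ {c c′ x y} → c′ * c ≈ 1# → c * x + y ≈ 0# → x ≈ (- c′) * y
  c*x+y≈0⇒x≈-c′*y {c} {c′} {x} {y} c′c≈1 cx+y≈0 = begin
    x              ≈⟨ *-identityˡ x ⟨
    1# * x         ≈⟨ *-congʳ c′c≈1 ⟨
    (c′ * c) * x   ≈⟨ *-assoc c′ c x ⟩
    c′ * (c * x)   ≈⟨ *-congˡ (inverseˡ-unique (c * x) y cx+y≈0) ⟩
    c′ * (- y)     ≈⟨ -‿distribʳ-* c′ y ⟨
    - (c′ * y)     ≈⟨ -‿distribˡ-* c′ y ⟩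
    (- c′) * y     ∎

  c·v⊕w≋0⇒v≋-c′·w : ∀ {n c c′} {v w : Vec F n} → c′ * c ≈ 1# → c · v ⊕ w ≋ 0v → v ≋ (- c′) · w
  c·v⊕w≋0⇒v≋-c′·w {v = []}    {[]}    _     []                 = []
  c·v⊕w≋0⇒v≋-c′·w {v = _ ∷ _} {_ ∷ _} c′c≈1 (cx+y≈0 ∷ cv+w≋0) =
    c*x+y≈0⇒x≈-c′*y c′c≈1 cx+y≈0 ∷ c·v⊕w≋0⇒v≋-c′·w c′c≈1 cv+w≋0

  record IsLinear (Scalar : F → Set) {n n′} (L : Vec F n → Vec F n′) : Set where
    field
      cong   : ∀ {v w} → v ≋ w → L v ≋ L w
      ⊕-homo : ∀ v w → L (v ⊕ w) ≋ L v ⊕ L w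
      ·-homo : ∀ c v → Scalar c → L (c · v) ≋ c · L v
      0-homo : L 0v ≋ 0v

  IsLinear-∘ : ∀ {P n n′ n″} {L : Vec F n′ → Vec F n″} {K : Vec F n → Vec F n′} →
               IsLinear P L → IsLinear P K → IsLinear P (L ∘ K)
  IsLinear-∘ {L = L} {K} L-lin K-lin = record
    { cong   = L.cong ∘ K.cong
    ; ⊕-homo = λ v w → ≋-trans (L.cong (K.⊕-homo v w)) (L.⊕-homo (K v) (K w))
    ; ·-homo = λ c v Pc → ≋-trans (L.cong (K.·-homo c v Pc)) (L.·-homo c (K v) Pc)
    ; 0-homo = ≋-trans (L.cong K.0-homo) L.0-homo
    }
    where
    module L = IsLinear L-lin
    module K = IsLinear K-lin

  comb-homo : ∀ {P n n′ d} {L : Vec F n → Vec F n′} → IsLinear P L →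
              (a : Vec F d) → All P a → (b : Vec (Vec F n) d) → L (comb a b) ≋ comb a (map L b)
  comb-homo L-lin []      []         []      = IsLinear.0-homo L-lin
  comb-homo L-lin (c ∷ a) (Pc ∷ Pa) (v ∷ b) =
    ≋-trans (IsLinear.⊕-homo L-lin _ _) (⊕-cong (IsLinear.·-homo L-lin c v Pc) (comb-homo L-lin a Pa b))

module Dimension (R : CommutativeRing 0ℓ 0ℓ) (q : ℕ) where
  open CommutativeRing R renaming (Carrier to F)
  open Vectors R

  HasDimFq-resp : ∀ {n} {W W′ : Vec F n → Set} {d} → (∀ {v} → W v → W′ v) → (∀ {v} → W′ v → W v) →
                  HasDimFq R q W d → HasDimFq R q W′ d
  HasDimFq-resp W⇒W′ W′⇒W (b , independent , closed , spans) =
    b , independent , (λ a Fq-a → W⇒W′ (closed a Fq-a)) , (λ v → spans v ∘ W′⇒W)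

  Image : ∀ {n n′} → (Vec F n → Vec F n′) → (Vec F n → Set) → Vec F n′ → Set
  Image L W u = ∃ λ w → W w × u ≋ L w

  HasDimFq-image : ∀ {n n′} {L : Vec F n → Vec F n′} {W d} →
                   IsLinear (InFq R q) L → (∀ v → L v ≋ 0v → v ≋ 0v) →
                   HasDimFq R q W d → HasDimFq R q (Image L W) d
  HasDimFq-image {L = L} L-lin L-injective (b , independent , closed , spans) =
    map L b ,
    (λ a Fq-a La≋0 → independent a Fq-a (L-injective _ (≋-trans (comb-homo L-lin a Fq-a b) La≋0))) ,
    (λ a Fq-a → comb a b , closed a Fq-a , ≋-sym (comb-homo L-lin a Fq-a b)) ,
    λ { u (w , Ww , u≋Lw) → let (a , Fq-a , w≋ab) = spans w Ww in
          a , Fq-a , ≋-trans u≋Lw (≋-trans (IsLinear.cong L-lin w≋ab) (comb-homo L-lin a Fq-a b)) }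

  _⊗_ : ∀ {n₁ n₂} → (Vec F n₁ → Set) → (Vec F n₂ → Set) → Vec F (n₁ ℕ.+ n₂) → Set
  (W₁ ⊗ W₂) v = ∃₂ λ v₁ v₂ → W₁ v₁ × W₂ v₂ × v ≋ v₁ ++ v₂

  module _ {n₁ n₂ : ℕ} where

    inl : Vec F n₁ → Vec F (n₁ ℕ.+ n₂)
    inl v = v ++ 0v

    inr : Vec F n₂ → Vec F (n₁ ℕ.+ n₂)
    inr v = 0v ++ v

    0v≋0v⊕0v : ∀ {n} → 0v {n} ≋ 0v ⊕ 0v
    0v≋0v⊕0v = ≋-sym (⊕-identityˡ 0v)

    inl-linear : ∀ {P} → IsLinear P inl
    inl-linear = record
      { cong   = λ v≋w → Pointwise.++⁺ v≋w ≋-refl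
      ; ⊕-homo = λ v w → ≋-trans (Pointwise.++⁺ (≋-refl {x = v ⊕ w}) 0v≋0v⊕0v)
                                 (≡⇒≋ (≡.sym (Vec.zipWith-++ _+_ v 0v w 0v)))
      ; ·-homo = λ c v _ → ≋-trans (Pointwise.++⁺ (≋-refl {x = c · v}) (≋-sym (·-zeroʳ c)))
                                   (≡⇒≋ (≡.sym (Vec.map-++ (c *_) v 0v)))
      ; 0-homo = ≡⇒≋ (≡.sym (0v-++ n₁ n₂))
      }

    inr-linear : ∀ {P} → IsLinear P inr
    inr-linear = record
      { cong   = λ v≋w → Pointwise.++⁺ (≋-refl {x = 0v {n₁}}) v≋w
      ; ⊕-homo = λ v w → ≋-trans (Pointwise.++⁺ (0v≋0v⊕0v {n₁}) ≋-refl)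
                                 (≡⇒≋ (≡.sym (Vec.zipWith-++ _+_ 0v v 0v w)))
      ; ·-homo = λ c v _ → ≋-trans (Pointwise.++⁺ (≋-sym (·-zeroʳ {n₁} c)) ≋-refl)
                                   (≡⇒≋ (≡.sym (Vec.map-++ (c *_) 0v v)))
      ; 0-homo = ≡⇒≋ (≡.sym (0v-++ n₁ n₂))
      }

    comb-inl-inr : ∀ {d₁ d₂} (a₁ : Vec F d₁) (a₂ : Vec F d₂) → All (InFq R q) a₁ → All (InFq R q) a₂ →
                   ∀ b₁ b₂ →
                   comb (a₁ ++ a₂) (map inl b₁ ++ map inr b₂) ≋ comb a₁ b₁ ++ comb a₂ b₂
    comb-inl-inr a₁ a₂ Fq-a₁ Fq-a₂ b₁ b₂ = ≋-trans (comb-++ a₁ a₂ _ _)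
      (≋-trans (⊕-cong (≋-sym (comb-homo inl-linear a₁ Fq-a₁ b₁)) (≋-sym (comb-homo inr-linear a₂ Fq-a₂ b₂)))
      (≋-trans (≡⇒≋ (Vec.zipWith-++ _+_ (comb a₁ b₁) 0v 0v (comb a₂ b₂)))
               (Pointwise.++⁺ (⊕-identityʳ (comb a₁ b₁)) (⊕-identityˡ (comb a₂ b₂)))))

  HasDimFq-⊗ : ∀ {n₁ n₂} {W₁ : Vec F n₁ → Set} {W₂ : Vec F n₂ → Set} {d₁ d₂} →
               HasDimFq R q W₁ d₁ → HasDimFq R q W₂ d₂ → HasDimFq R q (W₁ ⊗ W₂) (d₁ ℕ.+ d₂)
  HasDimFq-⊗ {n₁} {n₂} {W₁} {W₂} {d₁}
             (b₁ , independent₁ , closed₁ , spans₁) (b₂ , independent₂ , closed₂ , spans₂) =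
    map inl b₁ ++ map inr b₂ , independent , closed , spans
    where
    independent : ∀ a → All (InFq R q) a → comb a (map inl b₁ ++ map inr b₂) ≋ 0v → All (_≈ 0#) a
    independent a Fq-a ab≋0 with a₁ , a₂ , ≡.refl ← Vec.splitAt d₁ a =
      let (Fq-a₁ , Fq-a₂) = AllP.++⁻ a₁ Fq-a
          (a₁b₁≋0 , a₂b₂≋0) = Pointwise.++⁻ (comb a₁ b₁) 0v
                                (≋-trans (≋-sym (comb-inl-inr a₁ a₂ Fq-a₁ Fq-a₂ b₁ b₂))
                                         (≋-trans ab≋0 (≡⇒≋ (0v-++ n₁ n₂))))
      in AllP.++⁺ (independent₁ a₁ Fq-a₁ a₁b₁≋0) (independent₂ a₂ Fq-a₂ a₂b₂≋0)
    closed : ∀ a → All (InFq R q) a → (W₁ ⊗ W₂) (comb a (map inl b₁ ++ map inr b₂))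
    closed a Fq-a with a₁ , a₂ , ≡.refl ← Vec.splitAt d₁ a =
      let (Fq-a₁ , Fq-a₂) = AllP.++⁻ a₁ Fq-a
      in comb a₁ b₁ , comb a₂ b₂ , closed₁ a₁ Fq-a₁ , closed₂ a₂ Fq-a₂ ,
         comb-inl-inr a₁ a₂ Fq-a₁ Fq-a₂ b₁ b₂
    spans : ∀ v → (W₁ ⊗ W₂) v → ∃ λ a → All (InFq R q) a × v ≋ comb a (map inl b₁ ++ map inr b₂)
    spans v (v₁ , v₂ , Wv₁ , Wv₂ , v≋v₁++v₂) =
      let (a₁ , Fq-a₁ , v₁≋) = spans₁ v₁ Wv₁
          (a₂ , Fq-a₂ , v₂≋) = spans₂ v₂ Wv₂
      in a₁ ++ a₂ , AllP.++⁺ Fq-a₁ Fq-a₂ ,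
         ≋-trans v≋v₁++v₂
                 (≋-trans (Pointwise.++⁺ v₁≋ v₂≋) (≋-sym (comb-inl-inr a₁ a₂ Fq-a₁ Fq-a₂ b₁ b₂)))

module FixedPoints (R : CommutativeRing 0ℓ 0ℓ) (isField : IsField R) {N : ℕ} (size : HasSize R N)
                   {q m : ℕ} (N≡q^m : N ≡ q ℕ.^ m) (1<q : 1 < q) (1≤m : 1 ≤ m) where
  open CommutativeRing R renaming (Carrier to F)
  open import Relation.Binary.Reasoning.Setoid setoid
  open import Algebra.Properties.Ring ring using (-‿distribʳ-*; x[y-z]≈xy-xz)
  open import Algebra.Properties.Group +-group using (x≈y⇒x∙y⁻¹≈ε; x∙y⁻¹≈ε⇒x≈y)
  open Powers R
  open Field R isField
  open Polynomials R isField
  open FiniteField R isField size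
  open Inverse size using (to; from; strictlyInverseˡ)

  Fq : F → Set
  Fq = InFq R q

  Fq-cong : ∀ {x y} → x ≈ y → Fq x → Fq y
  Fq-cong x≈y Fq-x = trans (^-congˡ q (sym x≈y)) (trans Fq-x x≈y)

  q₁ : ℕ
  q₁ = ℕ.pred q

  q≡1+q₁ : q ≡ suc q₁
  q≡1+q₁ = ≡.sym (ℕ.suc-pred q {{ℕ.>-nonZero (ℕ.<-trans (s≤s z≤n) 1<q)}})

  x^q-x-monic : Monic q (λ x → x ^ q - x)
  x^q-x-monic = Monic-+-Poly< (Monic-^ q) (Poly<-mono 1<q -x-poly)
    where
    -x-poly : Poly< 2 (λ x → - x)
    -x-poly = 0# , (λ _ → - 1#) ,
      (- 1# , (λ _ → 0#) , (λ _ → refl) , λ x → sym (trans (+-congˡ (zeroʳ x)) (+-identityʳ _))) ,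
      λ x → sym (trans (+-identityˡ _) (trans (sym (-‿distribʳ-* x 1#)) (-‿cong (*-identityʳ x))))

  Monic-geometric : ∀ k → Monic (q₁ ℕ.* k) (λ x → geometric (x ^ q₁) (suc k))
  Monic-geometric k = Monic-resp (Monic-+-Poly< (Monic-^ (q₁ ℕ.* k)) (lower k)) (λ x → +-congʳ (^-assocʳ x q₁ k))
    where
    lower : ∀ k → Poly< (q₁ ℕ.* k) (λ x → geometric (x ^ q₁) k)
    lower zero    = Poly<-resp (Poly<-zero (q₁ ℕ.* 0)) (λ _ → refl)
    lower (suc k) = Poly<-mono (ℕ.≤-trans (ℕ.+-monoˡ-≤ (q₁ ℕ.* k) (ℕ.≤-pred (ℕ.≤-trans 1<q (ℕ.≤-reflexive q≡1+q₁))))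
                                          (ℕ.≤-reflexive (≡.sym (ℕ.*-suc q₁ k))))
                               (Monic⇒Poly< (Monic-geometric k))

  private
    decomposition : ∃ λ M′ → N ≡ suc (q₁ ℕ.* suc M′)
    decomposition with M′ , eq ← [1+a]^m≡1+a*[1+M] q₁ m 1≤m =
      M′ , ≡.trans N≡q^m (≡.trans (≡.cong (ℕ._^ m) q≡1+q₁) eq)

  M′ : ℕ
  M′ = proj₁ decomposition

  N≡q+q₁*M′ : N ≡ q ℕ.+ q₁ ℕ.* M′
  N≡q+q₁*M′ = ≡.trans (proj₂ decomposition)
                      (≡.trans (≡.cong suc (ℕ.*-suc q₁ M′)) (≡.cong (ℕ._+ q₁ ℕ.* M′) (≡.sym q≡1+q₁)))

  x^N-x≈[x^q-x]*geometric : ∀ x → x ^ N - x ≈ (x ^ q - x) * geometric (x ^ q₁) (suc M′)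
  x^N-x≈[x^q-x]*geometric x = begin
    x ^ N - x                    ≡⟨ ≡.cong (λ n → x ^ n - x) (proj₂ decomposition) ⟩
    x * x ^ (q₁ ℕ.* suc M′) - x  ≈⟨ +-cong (*-congˡ (^-assocʳ x q₁ (suc M′))) (-‿cong (*-identityʳ x)) ⟨
    x * y ^ suc M′ - x * 1#      ≈⟨ x[y-z]≈xy-xz x _ 1# ⟨
    x * (y ^ suc M′ - 1#)        ≈⟨ *-congˡ ([y-1]*geometric≈y^k-1 y (suc M′)) ⟨
    x * ((y - 1#) * G)           ≈⟨ *-assoc x _ G ⟨
    x * (y - 1#) * G             ≈⟨ *-congʳ (x[y-z]≈xy-xz x y 1#) ⟩
    (x * y - x * 1#) * G         ≡⟨ ≡.cong (λ n → (x ^ n - x * 1#) * G) (≡.sym q≡1+q₁) ⟩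
    (x ^ q - x * 1#) * G         ≈⟨ *-congʳ (+-congˡ (-‿cong (*-identityʳ x))) ⟩
    (x ^ q - x) * G              ∎
    where
    y G : F
    y = x ^ q₁
    G = geometric y (suc M′)

  fixed : Fin N → Bool
  fixed j = isYes (to j ^ q ≟ to j)

  κ : ℕ
  κ = count fixed

  enumFq : Fin κ → F
  enumFq = to ∘ select fixed

  enumFq-Fq : ∀ i → Fq (enumFq i)
  enumFq-Fq i = toWitness (select-true fixed i)

  enumFq-injective : Injective _≡_ _≈_ enumFq
  enumFq-injective = select-injective fixed ∘ to-injective

  enumFq-surjective : ∀ x → Fq x → ∃ λ i → enumFq i ≈ x
  enumFq-surjective x Fq-x with i , eq ← select-surjective fixed (from x) (fromWitness (Fq-cong (sym (strictlyInverseˡ x)) Fq-x)) =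
    i , trans (reflexive (≡.cong to eq)) (strictlyInverseˡ x)

  κ≤q : κ ≤ q
  κ≤q = Monic-roots≤degree x^q-x-monic enumFq enumFq-injective (x≈y⇒x∙y⁻¹≈ε ∘ enumFq-Fq)

  -- Every x with x^q ≉ x is a root of the cofactor of x^q - x in x^N - x, which is monic of degree N - q.
  q≤κ : q ≤ κ
  q≤κ = ℕ.+-cancelʳ-≤ (count moved) q κ
    (ℕ.≤-trans (ℕ.+-monoʳ-≤ q count-moved≤q₁*M′)
               (ℕ.≤-reflexive (≡.trans (≡.sym N≡q+q₁*M′) (≡.sym (count+count-not≡n fixed)))))
    where
    moved : Fin N → Bool
    moved = not ∘ fixed
    root : ∀ k → geometric (to (select moved k) ^ q₁) (suc M′) ≈ 0#
    root k = x*y≈0⇒y≈0 (toWitnessFalse (select-true moved k) ∘ x∙y⁻¹≈ε⇒x≈y _ _)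
                        (trans (sym (x^N-x≈[x^q-x]*geometric x)) (x≈y⇒x∙y⁻¹≈ε (fermat x)))
      where
      x : F
      x = to (select moved k)
    count-moved≤q₁*M′ : count moved ≤ q₁ ℕ.* M′
    count-moved≤q₁*M′ =
      Monic-roots≤degree (Monic-geometric M′) (to ∘ select moved) (select-injective moved ∘ to-injective) root

  κ≡q : κ ≡ q
  κ≡q = ℕ.≤-antisym κ≤q q≤κ

  N≡κ^m : N ≡ κ ℕ.^ m
  N≡κ^m = ≡.trans N≡q^m (≡.cong (ℕ._^ m) (≡.sym κ≡q))

  1<κ : 1 < κ
  1<κ = ℕ.<-≤-trans 1<q (ℕ.≤-reflexive (≡.sym κ≡q))

module Subfield (R : CommutativeRing 0ℓ 0ℓ) (isField : IsField R) {N : ℕ} (size : HasSize R N)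
                {q m : ℕ} (N≡q^m : N ≡ q ℕ.^ m) (1<q : 1 < q) (1≤m : 1 ≤ m)
                (^q-additive : Powers.AdditiveExponent R q) where
  open CommutativeRing R renaming (Carrier to F)
  open import Relation.Binary.Reasoning.Setoid setoid
  open import Algebra.Properties.Ring ring using (-‿distribˡ-*)
  open import Algebra.Properties.Group +-group using (⁻¹-involutive; ε⁻¹≈ε)
  open Powers R
  open Field R isField
  open FiniteField R isField size
  open FixedPoints R isField size N≡q^m 1<q 1≤m
  open Inverse size using (to; from; strictlyInverseˡ)
  open Vectors R
  open Dimension R q

  Fq-0 : Fq 0#
  Fq-0 = 0^n≈0 (ℕ.<⇒≤ 1<q)

  Fq-1 : Fq 1#
  Fq-1 = 1^n≈1 q

  Fq-0s : ∀ k → All Fq (replicate k 0#)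
  Fq-0s zero    = []
  Fq-0s (suc k) = Fq-0 ∷ Fq-0s k

  Fq-+ : ∀ {x y} → Fq x → Fq y → Fq (x + y)
  Fq-+ Fq-x Fq-y = trans (^q-additive _ _) (+-cong Fq-x Fq-y)

  Fq-‿ : ∀ {x} → Fq x → Fq (- x)
  Fq-‿ Fq-x = trans (-‿^ (ℕ.<⇒≤ 1<q) ^q-additive _) (-‿cong Fq-x)

  Fq-* : ∀ {x y} → Fq x → Fq y → Fq (x * y)
  Fq-* Fq-x Fq-y = trans (^-distrib-* _ _ q) (*-cong Fq-x Fq-y)

  Fq-inverse : ∀ {x} (x≉0 : x ≉ 0#) → Fq x → Fq (inverse x x≉0)
  Fq-inverse {x} x≉0 Fq-x = *-cancelʳ-nonzero x≉0 (begin
    inverse x x≉0 ^ q * x     ≈⟨ *-congˡ Fq-x ⟨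
    inverse x x≉0 ^ q * x ^ q ≈⟨ ^-distrib-* _ x q ⟨
    (inverse x x≉0 * x) ^ q   ≈⟨ Fq-cong (sym (x⁻¹*x≈1 x x≉0)) Fq-1 ⟩
    inverse x x≉0 * x         ∎)

  x^q²≈[x^q]^q : ∀ x → x ^ (q ℕ.^ 2) ≈ (x ^ q) ^ q
  x^q²≈[x^q]^q x = trans (reflexive (≡.cong (λ e → x ^ (q ℕ.* e)) (ℕ.*-identityʳ q))) (sym (^-assocʳ x q q))

  ^q²-additive : AdditiveExponent (q ℕ.^ 2)
  ^q²-additive x y = begin
    (x + y) ^ (q ℕ.^ 2)                ≈⟨ x^q²≈[x^q]^q (x + y) ⟩
    ((x + y) ^ q) ^ q                  ≈⟨ ^-congˡ q (^q-additive x y) ⟩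
    (x ^ q + y ^ q) ^ q                ≈⟨ ^q-additive (x ^ q) (y ^ q) ⟩
    (x ^ q) ^ q + (y ^ q) ^ q          ≈⟨ +-cong (x^q²≈[x^q]^q x) (x^q²≈[x^q]^q y) ⟨
    x ^ (q ℕ.^ 2) + y ^ (q ℕ.^ 2)      ∎

  ^q-homo : ∀ {c} x → Fq c → (c * x) ^ q ≈ c * x ^ q
  ^q-homo {c} x Fq-c = trans (^-distrib-* c x q) (*-congʳ Fq-c)

  ^q²-homo : ∀ {c} x → Fq c → (c * x) ^ (q ℕ.^ 2) ≈ c * x ^ (q ℕ.^ 2)
  ^q²-homo {c} x Fq-c = begin
    (c * x) ^ (q ℕ.^ 2)   ≈⟨ x^q²≈[x^q]^q (c * x) ⟩
    ((c * x) ^ q) ^ q     ≈⟨ ^-congˡ q (^q-homo x Fq-c) ⟩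
    (c * x ^ q) ^ q       ≈⟨ ^q-homo (x ^ q) Fq-c ⟩
    c * (x ^ q) ^ q       ≈⟨ *-congˡ (x^q²≈[x^q]^q x) ⟨
    c * x ^ (q ℕ.^ 2)     ∎

  0^q²≈0 : 0# ^ (q ℕ.^ 2) ≈ 0#
  0^q²≈0 = trans (x^q²≈[x^q]^q 0#) (trans (^-congˡ q Fq-0) Fq-0)

  Independent : ∀ {n d} → Vec (Vec F n) d → Set
  Independent b = ∀ a → All Fq a → comb a b ≋ 0v → All (_≈ 0#) a

  comb-injective : ∀ {n d} {b : Vec (Vec F n) d} → Independent b →
                   ∀ {a a′} → All Fq a → All Fq a′ → comb a b ≋ comb a′ b → a ≋ a′
  comb-injective {b = b} independent {a} {a′} Fq-a Fq-a′ ab≋a′b = ⊖≈0⇒≋ a a′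
    (independent (a ⊖ a′) (All.zipWith (λ Fq-x Fq-y → Fq-+ Fq-x (Fq-‿ Fq-y)) Fq-a Fq-a′)
                 (≋-trans (comb-⊖ a a′ b) (⊖-≋0 ab≋a′b)))

  coefficients : ∀ {d} → Fin (κ ℕ.^ d) → Vec F d
  coefficients k = Vec.tabulate (enumFq ∘ Fin.finToFun k)

  coefficients-Fq : ∀ {d} (k : Fin (κ ℕ.^ d)) → All Fq (coefficients {d} k)
  coefficients-Fq {d} k = AllP.tabulate⁺ (enumFq-Fq ∘ Fin.finToFun {κ} {d} k)

  coefficients-injective : ∀ {d} {k k′ : Fin (κ ℕ.^ d)} → coefficients {d} k ≋ coefficients {d} k′ → k ≡ k′
  coefficients-injective {d} {k} {k′} eq =
    ≡.trans (≡.sym (Fin.funToFin-finToFin {d} {κ} k))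
            (≡.trans (funToFin-cong {d} {κ} (enumFq-injective ∘ Pointwise.tabulate⁻ eq)) (Fin.funToFin-finToFin {d} {κ} k′))

  coefficients-surjective : ∀ {d} (a : Vec F d) → All Fq a → ∃ λ (k : Fin (κ ℕ.^ d)) → coefficients {d} k ≋ a
  coefficients-surjective {d} a Fq-a =
    Fin.funToFin {d} {κ} index ,
    ≋-trans (Pointwise.tabulate⁺ (λ i → trans (reflexive (≡.cong enumFq (Fin.finToFun-funToFin {d} {κ} index i)))
                                              (proj₂ (preimage i))))
            (≡⇒≋ (Vec.tabulate∘lookup a))
    where
    preimage : ∀ i → ∃ λ j → enumFq j ≈ Vec.lookup a i
    preimage i = enumFq-surjective (Vec.lookup a i) (AllP.lookup⁺ Fq-a i)
    index : Fin d → Fin κ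
    index = proj₁ ∘ preimage

  InSpan : ∀ {n d} → Vec (Vec F n) d → Vec F n → Set
  InSpan {d = d} b v = ∃ λ (k : Fin (κ ℕ.^ d)) → comb (coefficients {d} k) b ≋ v

  inSpan? : ∀ {n d} (b : Vec (Vec F n) d) v → Dec (InSpan b v)
  inSpan? b v = Fin.any? (λ k → Pointwise.decidable _≟_ (comb (coefficients k) b) v)

  extend : ∀ {n d} {b : Vec (Vec F n) d} {v} → Independent b → ¬ InSpan b v → Independent (v ∷ b)
  extend {d = d} {b} {v} independent v∉b (c ∷ a) (Fq-c ∷ Fq-a) cv+ab≋0 with c ≟ 0#
  ... | yes c≈0 = c≈0 ∷ independent a Fq-a (≋-trans (≋-sym cv+ab≋ab) cv+ab≋0)
    where
    cv+ab≋ab : c · v ⊕ comb a b ≋ comb a b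
    cv+ab≋ab = ≋-trans (⊕-cong (≋-trans (·-cong c≈0 ≋-refl) (·-zeroˡ v)) ≋-refl) (⊕-identityˡ _)
  ... | no  c≉0 = contradiction
    (proj₁ a′-index , ≋-trans (comb-congˡ b (proj₂ a′-index)) (≋-trans (comb-scale _ a b) (≋-sym v≋a′b))) v∉b
    where
    -c⁻¹ : F
    -c⁻¹ = - inverse c c≉0
    v≋a′b : v ≋ -c⁻¹ · comb a b
    v≋a′b = c·v⊕w≋0⇒v≋-c′·w (x⁻¹*x≈1 c c≉0) cv+ab≋0
    a′-index : ∃ λ (k : Fin (κ ℕ.^ d)) → coefficients {d} k ≋ map (-c⁻¹ *_) a
    a′-index = coefficients-surjective (map (-c⁻¹ *_) a) (AllP.map⁺ (All.map (Fq-* (Fq-‿ (Fq-inverse c≉0 Fq-c))) Fq-a))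

  ≈⇒≋₁ : ∀ {v w : Vec F 1} → head v ≈ head w → v ≋ w
  ≈⇒≋₁ {_ ∷ []} {_ ∷ []} x≈y = x≈y ∷ []

  independent⇒κ^d≤N : ∀ {d} {b : Vec (Vec F 1) d} → Independent b → κ ℕ.^ d ≤ N
  independent⇒κ^d≤N {d} {b} independent = Fin.injective⇒≤ {f = from ∘ head ∘ element} λ {k} {k′} eq →
    coefficients-injective (comb-injective independent (coefficients-Fq k) (coefficients-Fq k′) (≈⇒≋₁ (from-injective eq)))
    where
    element : Fin (κ ℕ.^ d) → Vec F 1
    element k = comb (coefficients {d} k) b

  spanning⇒N≤κ^d : ∀ {d} (b : Vec (Vec F 1) d) → (∀ v → InSpan b v) → N ≤ κ ℕ.^ d
  spanning⇒N≤κ^d b spans = Fin.injective⇒≤ {f = proj₁ ∘ spans ∘ Vec.[_] ∘ to} λ {i} {j} eq →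
    to-injective (Pointwise.head (≋-trans (≋-sym (proj₂ (spans Vec.[ to i ])))
                                           (≋-trans (≡⇒≋ (≡.cong (λ k → comb (coefficients k) b) eq))
                                                    (proj₂ (spans Vec.[ to j ])))))

  spans-or-extends : ∀ {d} (b : Vec (Vec F 1) d) → Independent b → (∀ v → InSpan b v) ⊎ ∃ λ v → Independent (v ∷ b)
  spans-or-extends b independent with Fin.all? (λ i → inSpan? b Vec.[ to i ])
  ... | yes spans = inj₁ λ v →
    let (k , eq) = spans (from (head v)) in k , ≋-trans eq (≈⇒≋₁ (strictlyInverseˡ (head v)))
  ... | no ¬spans =
    let (i , i∉b) = Fin.¬∀⟶∃¬ N _ (λ i → inSpan? b Vec.[ to i ]) ¬spans in inj₂ (Vec.[ to i ] , extend independent i∉b)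

  independent-family : ∀ d → d ≤ m → ∃ λ (b : Vec (Vec F 1) d) → Independent b
  independent-family zero    _   = [] , λ { [] [] _ → [] }
  independent-family (suc d) d<m with b , independent ← independent-family d (ℕ.<⇒≤ d<m)
                                  with spans-or-extends b independent
  ... | inj₁ spans               = contradiction (spanning⇒N≤κ^d b spans)
                                     (ℕ.<⇒≱ (ℕ.<-≤-trans (ℕ.^-monoʳ-< κ 1<κ d<m) (ℕ.≤-reflexive (≡.sym N≡κ^m))))
  ... | inj₂ (v , independent′) = v ∷ b , independent′

  HasDimFq-F : HasDimFq R q (λ (_ : Vec F 1) → ⊤) m
  HasDimFq-F with b , independent ← independent-family m ℕ.≤-refl
             with spans-or-extends b independent
  ... | inj₁ spans =
    b , independent , (λ _ _ → tt) , λ v _ → let (k , eq) = spans v in coefficients k , coefficients-Fq k , ≋-sym eq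
  ... | inj₂ (v , independent′) = contradiction (independent⇒κ^d≤N independent′)
                                    (ℕ.<⇒≱ (ℕ.≤-<-trans (ℕ.≤-reflexive N≡κ^m) (ℕ.^-monoʳ-< κ 1<κ (ℕ.n<1+n m))))

  HasDimFq-Fˢ : ∀ s → HasDimFq R q (λ (_ : Vec F s) → ⊤) (m ℕ.* s)
  HasDimFq-Fˢ zero    = ≡.subst (HasDimFq R q _) (≡.sym (ℕ.*-zeroʳ m))
                          ([] , (λ { [] [] _ → [] }) , (λ _ _ → tt) , λ { [] _ → [] , [] , [] })
  HasDimFq-Fˢ (suc s) = ≡.subst (HasDimFq R q _) (≡.sym (ℕ.*-suc m s))
                          (HasDimFq-resp (λ _ → tt) (λ { {x ∷ v} _ → Vec.[ x ] , v , tt , tt , ≋-refl })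
                                         (HasDimFq-⊗ HasDimFq-F (HasDimFq-Fˢ s)))

  HasDimFq-·-closed : ∀ {n} {W : Vec F n → Set} {d} → HasDimFq R q W d →
                      ∀ {c v} → Fq c → W v → ∃ λ w → W w × w ≋ c · v
  HasDimFq-·-closed (b , _ , closed , spans) {c} {v} Fq-c Wv with a , Fq-a , v≋ab ← spans v Wv =
    comb (map (c *_) a) b , closed _ (AllP.map⁺ (All.map (Fq-* Fq-c) Fq-a)) ,
    ≋-trans (comb-scale c a b) (·-cong refl (≋-sym v≋ab))

  -- Two vectors of an F_q-line are F_q-dependent.
  HasDimFq-1⇒¬2+ : ∀ {n} {W : Vec F n → Set} {k} → HasDimFq R q W 1 → ¬ HasDimFq R q W (2 ℕ.+ k)
  HasDimFq-1⇒¬2+ {W = W} {k} (w ∷ [] , _ , _ , spans₁) (β₀ ∷ β₁ ∷ β , independent , closed , _) =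
    1≉0 (All.head (independent e₀ Fq-e₀
      (≋-trans (comb-e₀ β₀ (β₁ ∷ β)) (≋-trans β₀≋a₀w (≋-trans (·-cong a₀≈0 ≋-refl) (·-zeroˡ w))))))
    where
    zeros : Vec F k
    zeros = replicate k 0#
    e₀ e₁ : Vec F (2 ℕ.+ k)
    e₀ = 1# ∷ 0# ∷ zeros
    e₁ = 0# ∷ 1# ∷ zeros
    Fq-e₀ : All Fq e₀
    Fq-e₀ = Fq-1 ∷ Fq-0 ∷ Fq-0s k
    Fq-e₁ : All Fq e₁
    Fq-e₁ = Fq-0 ∷ Fq-1 ∷ Fq-0s k
    on-line : ∀ {u} → W u → ∃ λ c → Fq c × u ≋ c · w
    on-line {u} Wu with c ∷ [] , Fq-c ∷ [] , u≋ ← spans₁ u Wu = c , Fq-c , ≋-trans u≋ (comb-[ c ] w)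
    line₀ : ∃ λ c → Fq c × comb e₀ (β₀ ∷ β₁ ∷ β) ≋ c · w
    line₀ = on-line (closed e₀ Fq-e₀)
    line₁ : ∃ λ c → Fq c × comb e₁ (β₀ ∷ β₁ ∷ β) ≋ c · w
    line₁ = on-line (closed e₁ Fq-e₁)
    a₀ a₁ : F
    a₀ = proj₁ line₀
    a₁ = proj₁ line₁
    β₀≋a₀w : β₀ ≋ a₀ · w
    β₀≋a₀w = ≋-trans (≋-sym (comb-e₀ β₀ (β₁ ∷ β))) (proj₂ (proj₂ line₀))
    β₁≋a₁w : β₁ ≋ a₁ · w
    β₁≋a₁w = ≋-trans (≋-sym (≋-trans (comb-0∷ (1# ∷ zeros) β₀ (β₁ ∷ β)) (comb-e₀ β₁ β))) (proj₂ (proj₂ line₁))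
    a₁a₀-a₀a₁≈0 : a₁ * a₀ + (- a₀) * a₁ ≈ 0#
    a₁a₀-a₀a₁≈0 = trans (+-cong (*-comm a₁ a₀) (sym (-‿distribˡ-* a₀ a₁))) (-‿inverseʳ (a₀ * a₁))
    dependence : comb (a₁ ∷ - a₀ ∷ zeros) (β₀ ∷ β₁ ∷ β) ≋ 0v
    dependence =
      ≋-trans (⊕-cong (·-cong refl β₀≋a₀w) (≋-trans (⊕-cong (·-cong refl β₁≋a₁w) (comb-replicate-0 β)) (⊕-identityʳ _)))
      (≋-trans (⊕-cong (·-assoc a₁ a₀ w) (·-assoc (- a₀) a₁ w))
      (≋-trans (≋-sym (·-distribʳ _ _ w)) (≋-trans (·-cong a₁a₀-a₀a₁≈0 ≋-refl) (·-zeroˡ w))))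
    a₀≈0 : a₀ ≈ 0#
    a₀≈0 with _ ∷ -a₀≈0 ∷ _ ← independent _ (proj₁ (proj₂ line₁) ∷ Fq-‿ (proj₁ (proj₂ line₀)) ∷ Fq-0s k)
                                            dependence =
      trans (sym (⁻¹-involutive a₀)) (trans (-‿cong -a₀≈0) ε⁻¹≈ε)

  HasDimFq-suc⇒nonzero : ∀ {n} {W : Vec F n → Set} {d} → HasDimFq R q W (suc d) → ∃ λ v → W v × ¬ v ≋ 0v
  HasDimFq-suc⇒nonzero {d = d} (b , independent , closed , _) =
    comb e₀ b , closed e₀ (Fq-1 ∷ Fq-0s d) , λ e₀b≋0 → 1≉0 (All.head (independent e₀ (Fq-1 ∷ Fq-0s d) e₀b≋0))
    where
    e₀ : Vec F (suc d)
    e₀ = 1# ∷ replicate d 0#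

module ClubConstruction (R : CommutativeRing 0ℓ 0ℓ) (isField : IsField R) {N : ℕ} (size : HasSize R N)
                        {q m : ℕ} (N≡q^m : N ≡ q ℕ.^ m) (1<q : 1 < q) (1≤m : 1 ≤ m)
                        (^q-additive : Powers.AdditiveExponent R q)
                        (s : ℕ) (S : CommutativeRing.Carrier R → Set) where
  open CommutativeRing R renaming (Carrier to F)
  open import Relation.Binary.Reasoning.Setoid setoid
  open import Algebra.Properties.CommutativeSemigroup +-commutativeSemigroup using (interchange)
  open Powers R
  open Field R isField
  open FiniteField R isField size
  open Vectors R
  open Dimension R q
  open FixedPoints R isField size N≡q^m 1<q 1≤m using (Fq)
  open Subfield R isField size N≡q^m 1<q 1≤m ^q-additive

  U : Vec F (1 ℕ.+ s ℕ.* 2) → Set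
  U = Uset R q s S

  S₁ : Vec F 1 → Set
  S₁ v = S (head v)

  pairs-linear : ∀ {t} → IsLinear Fq (pairs R q {t})
  pairs-linear = record { cong = cong′ ; ⊕-homo = ⊕-homo′ ; ·-homo = ·-homo′ ; 0-homo = 0-homo′ }
    where
    cong′ : ∀ {t} {x y : Vec F t} → x ≋ y → pairs R q x ≋ pairs R q y
    cong′ []            = []
    cong′ (a≈b ∷ x≋y) = a≈b ∷ ^-congˡ q a≈b ∷ cong′ x≋y
    ⊕-homo′ : ∀ {t} (x y : Vec F t) → pairs R q (x ⊕ y) ≋ pairs R q x ⊕ pairs R q y
    ⊕-homo′ []      []      = []
    ⊕-homo′ (a ∷ x) (b ∷ y) = refl ∷ ^q-additive a b ∷ ⊕-homo′ x y
    ·-homo′ : ∀ {t} c (x : Vec F t) → Fq c → pairs R q (c · x) ≋ c · pairs R q x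
    ·-homo′ c []      _    = []
    ·-homo′ c (a ∷ x) Fq-c = refl ∷ ^q-homo a Fq-c ∷ ·-homo′ c x Fq-c
    0-homo′ : ∀ {t} → pairs R q (0v {t}) ≋ 0v
    0-homo′ {zero}  = []
    0-homo′ {suc t} = refl ∷ Fq-0 ∷ 0-homo′

  pairs≋0⇒≋0 : ∀ {t} (x : Vec F t) → pairs R q x ≋ 0v → x ≋ 0v
  pairs≋0⇒≋0 []      []              = []
  pairs≋0⇒≋0 (a ∷ x) (a≈0 ∷ _ ∷ x≋0) = a≈0 ∷ pairs≋0⇒≋0 x x≋0

  uVec-cong : ∀ {t} {x y : Vec F t} {ζ ζ′} → x ≋ y → ζ ≈ ζ′ → uVec R q x ζ ≋ uVec R q y ζ′
  uVec-cong []            ζ≈ζ′ = ζ≈ζ′ ∷ []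
  uVec-cong (a≈b ∷ x≋y) ζ≈ζ′ =
    +-cong a≈b ζ≈ζ′ ∷ ^-congˡ q a≈b ∷ ^-congˡ (q ℕ.^ 2) a≈b ∷ IsLinear.cong pairs-linear x≋y

  uVec-⊕ : ∀ {t} (x y : Vec F t) ζ ζ′ → uVec R q (x ⊕ y) (ζ + ζ′) ≋ uVec R q x ζ ⊕ uVec R q y ζ′
  uVec-⊕ []      []      ζ ζ′ = refl ∷ []
  uVec-⊕ (a ∷ x) (b ∷ y) ζ ζ′ =
    interchange a b ζ ζ′ ∷ ^q-additive a b ∷ ^q²-additive a b ∷ IsLinear.⊕-homo pairs-linear x y

  uVec-· : ∀ {t} c (x : Vec F t) ζ → Fq c → uVec R q (c · x) (c * ζ) ≋ c · uVec R q x ζ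
  uVec-· c []      ζ _    = refl ∷ []
  uVec-· c (a ∷ x) ζ Fq-c =
    sym (distribˡ c a ζ) ∷ ^q-homo a Fq-c ∷ ^q²-homo a Fq-c ∷ IsLinear.·-homo pairs-linear c x Fq-c

  uVec-0v : ∀ {t} ζ → uVec R q (0v {t}) ζ ≋ ζ ∷ 0v
  uVec-0v {zero}  ζ = refl ∷ []
  uVec-0v {suc t} ζ = +-identityˡ ζ ∷ Fq-0 ∷ 0^q²≈0 ∷ IsLinear.0-homo pairs-linear

  uVec≋c∷0⇒x≋0 : ∀ {t} (x : Vec F t) {ζ c} → uVec R q x ζ ≋ c ∷ 0v → x ≋ 0v
  uVec≋c∷0⇒x≋0 []      _                        = []
  uVec≋c∷0⇒x≋0 (a ∷ x) (_ ∷ a^q≈0 ∷ _ ∷ x-pairs≋0) = ^≈0⇒≈0 q a^q≈0 ∷ pairs≋0⇒≋0 x x-pairs≋0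

  uMap : Vec F (suc s) → Vec F (1 ℕ.+ s ℕ.* 2)
  uMap (ζ ∷ x) = uVec R q x ζ

  uMap-linear : IsLinear Fq uMap
  uMap-linear = record
    { cong   = λ { (ζ≈ζ′ ∷ x≋y) → uVec-cong x≋y ζ≈ζ′ }
    ; ⊕-homo = λ { (ζ ∷ x) (ζ′ ∷ y) → uVec-⊕ x y ζ ζ′ }
    ; ·-homo = λ { c (ζ ∷ x) Fq-c → uVec-· c x ζ Fq-c }
    ; 0-homo = uVec-0v 0#
    }

  uMap-injective : ∀ v → uMap v ≋ 0v → v ≋ 0v
  uMap-injective (ζ ∷ x) uVec≋0 = ζ≈0 ∷ x≋0
    where
    x≋0 : x ≋ 0v
    x≋0 = uVec≋c∷0⇒x≋0 x uVec≋0
    ζ≈0 : ζ ≈ 0#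
    ζ≈0 = Pointwise.head (≋-trans (≋-sym (uVec-0v ζ)) (≋-trans (uVec-cong (≋-sym x≋0) refl) uVec≋0))

  rank : ∀ {i} → HasDimFq₁ R q S i → HasRank R q U (m ℕ.* s ℕ.+ i)
  rank {i} dimS = ≡.subst (HasDimFq R q U) (ℕ.+-comm i (m ℕ.* s))
    (HasDimFq-resp image⇒U U⇒image (HasDimFq-image uMap-linear uMap-injective (HasDimFq-⊗ dimS (HasDimFq-Fˢ s))))
    where
    image⇒U : ∀ {v} → Image uMap (S₁ ⊗ (λ (_ : Vec F s) → ⊤)) v → U v
    image⇒U (_ , (ζ ∷ [] , x , Sζ , _ , w≋ζ∷x) , v≋) =
      x , ζ , Sζ , ≋-trans v≋ (IsLinear.cong uMap-linear w≋ζ∷x)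
    U⇒image : ∀ {v} → U v → Image uMap (S₁ ⊗ (λ (_ : Vec F s) → ⊤)) v
    U⇒image (x , ζ , Sζ , v≋) = ζ ∷ x , (Vec.[ ζ ] , x , Sζ , tt , ≋-refl) , v≋

  Fq-from-coordinates : ∀ {a b c} → a ≉ 0# → b ≈ c * a → b ^ q ≈ c * a ^ q → Fq c
  Fq-from-coordinates {a} {b} {c} a≉0 b≈ca b^q≈ca^q = sym (*-cancelʳ-nonzero (^-nonzero q a≉0) (begin
    c * a ^ q     ≈⟨ b^q≈ca^q ⟨
    b ^ q         ≈⟨ ^-congˡ q b≈ca ⟩
    (c * a) ^ q   ≈⟨ ^-distrib-* c a q ⟩
    c ^ q * a ^ q ∎))

  pairs-scalar-Fq : ∀ {t} (x y : Vec F t) {c} → pairs R q y ≋ c · pairs R q x → ¬ All (_≈ 0#) x → Fq c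
  pairs-scalar-Fq []      []      _                           x≉0 = contradiction [] x≉0
  pairs-scalar-Fq (a ∷ x) (b ∷ y) (b≈ca ∷ b^q≈ca^q ∷ y≋cx) x≉0 with a ≟ 0#
  ... | yes a≈0 = pairs-scalar-Fq x y y≋cx (x≉0 ∘ (a≈0 ∷_))
  ... | no  a≉0 = Fq-from-coordinates a≉0 b≈ca b^q≈ca^q

  uVec-scalar-Fq : ∀ {t} (x y : Vec F t) {ζ ζ′ c} → uVec R q y ζ′ ≋ c · uVec R q x ζ → ¬ All (_≈ 0#) x → Fq c
  uVec-scalar-Fq []      []      _                                  x≉0 = contradiction [] x≉0
  uVec-scalar-Fq (a ∷ x) (b ∷ y) (_ ∷ b^q≈ca^q ∷ b^q²≈ca^q² ∷ y≋cx) x≉0 with a ≟ 0#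
  ... | yes a≈0 = pairs-scalar-Fq x y y≋cx (x≉0 ∘ (a≈0 ∷_))
  ... | no  a≉0 = Fq-from-coordinates (^-nonzero q a≉0) b^q≈ca^q
                    (trans (sym (x^q²≈[x^q]^q b)) (trans b^q²≈ca^q² (*-congˡ (x^q²≈[x^q]^q a))))

  U-resp : ∀ {v w} → U v → w ≋ v → U w
  U-resp (x , ζ , Sζ , v≋) w≋v = x , ζ , Sζ , ≋-trans w≋v v≋

  U-·-closed : ∀ {i} → HasDimFq₁ R q S i → ∀ {c v} → Fq c → U v → U (c · v)
  U-·-closed dimS {c} Fq-c (x , ζ , Sζ , v≋)
    with ζ′ ∷ [] , Sζ′ , ζ′≈cζ ∷ [] ← HasDimFq-·-closed dimS {v = Vec.[ ζ ]} Fq-c Sζ =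
    c · x , ζ′ , Sζ′ , ≋-trans (·-cong refl v≋) (≋-trans (≋-sym (uVec-· c x ζ Fq-c)) (uVec-cong ≋-refl (sym ζ′≈cζ)))

  module Axis {i} (dimS : HasDimFq₁ R q S (suc i)) where

    private
      nonzero-ζ : ∃ λ v → S₁ v × ¬ v ≋ 0v
      nonzero-ζ = HasDimFq-suc⇒nonzero dimS

    ζ₀ : F
    ζ₀ = head (proj₁ nonzero-ζ)

    ζ₀≉0 : ζ₀ ≉ 0#
    ζ₀≉0 = proj₂ (proj₂ nonzero-ζ) ∘ ≈⇒≋₁

    u : Vec F (1 ℕ.+ s ℕ.* 2)
    u = uVec R q (0v {s}) ζ₀

    Uu : U u
    Uu = 0v , ζ₀ , proj₁ (proj₂ nonzero-ζ) , ≋-refl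

    u≢0 : NonZeroV R q u
    u≢0 u≋0 = ζ₀≉0 (Pointwise.head (≋-trans (≋-sym (uVec-0v ζ₀)) u≋0))

    c·u≋cζ₀∷0 : ∀ c → c · u ≋ (c * ζ₀) ∷ 0v
    c·u≋cζ₀∷0 c = ≋-trans (·-cong refl (uVec-0v ζ₀)) (refl ∷ ·-zeroʳ c)

    axis⇒same-point : ∀ {v} {x : Vec F s} {ζ} → v ≋ uVec R q x ζ → x ≋ 0v → SamePoint R q v u
    axis⇒same-point {v} {x} {ζ} v≋ x≋0 = ζ * ζ₀⁻¹ ,
      ≋-trans v≋ (≋-trans (uVec-cong x≋0 refl)
                 (≋-trans (uVec-0v ζ) (≋-sym (≋-trans (c·u≋cζ₀∷0 (ζ * ζ₀⁻¹)) (ζζ₀⁻¹ζ₀≈ζ ∷ ≋-refl)))))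
      where
      ζ₀⁻¹ : F
      ζ₀⁻¹ = inverse ζ₀ ζ₀≉0
      ζζ₀⁻¹ζ₀≈ζ : ζ * ζ₀⁻¹ * ζ₀ ≈ ζ
      ζζ₀⁻¹ζ₀≈ζ = trans (*-assoc ζ ζ₀⁻¹ ζ₀) (trans (*-congˡ (x⁻¹*x≈1 ζ₀ ζ₀≉0)) (*-identityʳ ζ))

    weight-u : Weight R q U u (suc i)
    weight-u = HasDimFq-resp image⇒ ⇒image (HasDimFq-image (IsLinear-∘ uMap-linear inl-linear) axis-injective dimS)
      where
      axis-injective : ∀ w → uMap (inl {1} {s} w) ≋ 0v → w ≋ 0v
      axis-injective (ζ ∷ []) uVec≋0 with ζ≈0 ∷ _ ← uMap-injective _ uVec≋0 = ζ≈0 ∷ []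
      image⇒ : ∀ {v} → Image (uMap ∘ inl {1} {s}) S₁ v → U v × SamePoint R q v u
      image⇒ (ζ ∷ [] , Sζ , v≋) = (0v , ζ , Sζ , v≋) , axis⇒same-point v≋ ≋-refl
      ⇒image : ∀ {v} → U v × SamePoint R q v u → Image (uMap ∘ inl {1} {s}) S₁ v
      ⇒image ((x , ζ , Sζ , v≋) , c , v≋cu) =
        ζ ∷ [] , Sζ ,
        ≋-trans v≋ (uVec-cong (uVec≋c∷0⇒x≋0 x (≋-trans (≋-sym v≋) (≋-trans v≋cu (c·u≋cζ₀∷0 c)))) refl)

    weight-1 : ∀ {u′} → U u′ → NonZeroV R q u′ → ¬ SamePoint R q u′ u → Weight R q U u′ 1
    weight-1 {u′} Uu′@(x , ζ , Sζ , u′≋) u′≢0 u′≁u = u′ ∷ [] , independent , closed , spans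
      where
      x≉0 : ¬ All (_≈ 0#) x
      x≉0 x≈0 = u′≁u (axis⇒same-point u′≋ (All≈0⇒≋0 x≈0))
      independent : ∀ a → All Fq a → comb a (u′ ∷ []) ≋ 0v → All (_≈ 0#) a
      independent (c ∷ []) _ cu′≋0 with c ≟ 0#
      ... | yes c≈0 = c≈0 ∷ []
      ... | no  c≉0 =
        contradiction (c·v≋0⇒v≋0 (x⁻¹*x≈1 c c≉0) (≋-trans (≋-sym (comb-[ c ] u′)) cu′≋0)) u′≢0
      closed : ∀ a → All Fq a → U (comb a (u′ ∷ [])) × SamePoint R q (comb a (u′ ∷ [])) u′
      closed (c ∷ []) (Fq-c ∷ []) = U-resp (U-·-closed dimS Fq-c Uu′) (comb-[ c ] u′) , c , comb-[ c ] u′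
      spans : ∀ v → U v × SamePoint R q v u′ → ∃ λ a → All Fq a × v ≋ comb a (u′ ∷ [])
      spans v ((y , ζ′ , _ , v≋) , c , v≋cu′) =
        c ∷ [] , uVec-scalar-Fq x y (≋-trans (≋-sym v≋) (≋-trans v≋cu′ (·-cong refl u′≋))) x≉0 ∷ [] ,
        ≋-trans v≋cu′ (≋-sym (comb-[ c ] u′))

  club : ∀ {i} → HasDimFq₁ R q S (2 ℕ.+ i) → IsClub R q U (2 ℕ.+ i)
  club dimS = u , Uu , u≢0 , weight-u , λ _ Uu′ u′≢0 u′≁u →
    let weight₁ = weight-1 Uu′ u′≢0 u′≁u in weight₁ , HasDimFq-1⇒¬2+ weight₁
    where open Axis dimS

open import Data.Nat using (_+_; _*_; _^_)

proposition5p8 : (q m s i : ℕ) → IsPrimePower q → 1 ≤ m → 1 ≤ s → 2 ≤ i →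
    (R : CommutativeRing 0ℓ 0ℓ) → IsField R → HasSize R (q ^ m) →
    (S : CommutativeRing.Carrier R → Set) → HasDimFq₁ R q S i →
    IsClub R q (Uset R q s S) i × HasRank R q (Uset R q s S) (m * s + i)
proposition5p8 .(p ^ e) m s (suc (suc i)) (p , e , p-prime , 1≤e , ≡.refl) 1≤m _ (s≤s (s≤s z≤n))
               R isField size S dimS = club dimS , rank dimS
  where
  open ClubConstruction R isField size ≡.refl (1<p^e p-prime 1≤e) 1≤m
    (Powers.^p^k-additive R p-prime (FiniteField.N≡p^k⇒p×1≈0 R isField size {p} {e * m} (ℕ.^-*-assoc p e m)) e) s S
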